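{- Let $\Phi:\mathbf{C}^{\mathcal D}_{CK}\to\mathbf{Sh}^{\mathcal D}$ be the unique Hopf algebra morphism with $\pi\circ\Phi\circ i=\varphi$. For every forest $F$ of $\mathbf{C}^{\mathcal D}_{CK}$ with at least one edge, $$\Phi(F)=\sum_{(\boldsymbol e_1,\dots,\boldsymbol e_k)\in\mathcal P(F)}\varphi\big(Cont_{\overline{\boldsymbol e_1}}(F)\big)\cdots\varphi\big(Cont_{\overline{\boldsymbol e_k}}(F)\big),$$ where $\overline{\boldsymbol e_j}=E(F)\setminus\boldsymbol e_j$.
   Context: $\mathbb{K}$ is a field of characteristic zero, $\mathcal D$ a nonempty set. $\mathbf{C}^{\mathcal D}_{CK}$ is spanned by rooted forests with edges decorated by $\mathcal D$, product disjoint union, modulo identification of the one-vertex tree with the unit; coproduct $\sum_{\boldsymbol e\subseteq E(F)}Part_{\boldsymbol e}(F)\otimes Cont_{\boldsymbol e}(F)$ ($Part_{\boldsymbol e}(F)$: all vertices and the edges of $\boldsymbol e$; $Cont_{\boldsymbol e}(F)$: contract the edges of $\boldsymbol e$). $i$ is the inclusion of the span of trees with at least one edge, $\varphi$ a linear map from this span to $\mathbb{K}(\mathcal D)$; $\mathbf{Sh}^{\mathcal D}$ is the shuffle Hopf algebra on words over $\mathcal D$, $\pi$ the projection onto words of length one identified with $\mathbb{K}(\mathcal D)$; products in the formula are concatenations extended multilinearly. Note $Cont_{\overline{\boldsymbol e_j}}(F)$, whose edges are $\boldsymbol e_j$, is (in $\mathbf{C}^{\mathcal D}_{CK}$) a tree.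 $\mathcal P(F)$, the set of generalized partitions of $F$, consists of the $k$-tuples $(\boldsymbol e_1,\dots,\boldsymbol e_k)$, $1\le k\le|E(F)|$, of subsets of $E(F)$ such that: (1) the $\boldsymbol e_i$ are nonempty, pairwise disjoint, with union $E(F)$; (2) the edges of each $\boldsymbol e_i$ all lie in the same connected component of $F$; (3) if $v,w$ are vertices incident to edges of $\boldsymbol e_i$ (the non-isolated vertices of $Part_{\boldsymbol e_i}(F)$) and the shortest path in $F$ between $v$ and $w$ contains an edge of $\boldsymbol e_j$ with $j\ne i$, then $j<i$. -}

module Defs where

open import Level using (Level; _⊔_)
open import Data.Bool using (Bool; true; false; not)
open import Data.Nat using (ℕ; zero; suc; _≤_)
open import Data.Fin using (Fin; _<_)
open import Data.Fin.Properties using (_≟_)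
open import Data.List using (List; []; _∷_; _++_; map; length; concatMap; allFin; lookup; foldr)
open import Data.List.Membership.Propositional using (_∈_; _∉_)
open import Data.List.Relation.Binary.Permutation.Homogeneous using (Permutation)
open import Data.List.Relation.Unary.Unique.Propositional using (Unique)
open import Data.Product using (Σ; ∃; _×_; _,_; proj₁; proj₂)
open import Relation.Nullary using (¬_; does)
open import Relation.Binary.PropositionalEquality using (_≡_)
open import Algebra.Bundles using (CommutativeRing)

-- Edge labels: decorations (in D),
-- possibly paired with extra marks (a Bool for an edge subset, a Fin k
-- for the block index of a generalized partition).

data Tree (L : Set) : Set where
  node : List (L × Tree L) → Tree L

Forest : Set → Set
Forest L = List (Tree L)

• : ∀ {L} → Tree L
• = node []

mapT  : ∀ {L M} → (L → M) → Tree L → Tree M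
mapCs : ∀ {L M} → (L → M) → List (L × Tree L) → List (M × Tree M)
mapT f (node cs) = node (mapCs f cs)
mapCs f [] = []
mapCs f ((l , t) ∷ cs) = (f l , mapT f t) ∷ mapCs f cs

mapF : ∀ {L M} → (L → M) → Forest L → Forest M
mapF f = map (mapT f)

edgesT  : ∀ {L} → Tree L → List L
edgesCs : ∀ {L} → List (L × Tree L) → List L
edgesT (node cs) = edgesCs cs
edgesCs [] = []
edgesCs ((l , t) ∷ cs) = l ∷ (edgesT t ++ edgesCs cs)

edgesF : ∀ {L} → Forest L → List L
edgesF [] = []
edgesF (t ∷ ts) = edgesT t ++ edgesF ts

nEdges : ∀ {L} → Forest L → ℕ
nEdges F = length (edgesF F)

-- Isomorphism of (non-planar) rooted decorated trees: children may be
-- permuted, recursively.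

data _≅_ {L : Set} : Tree L → Tree L → Set
data _≅E_ {L : Set} : L × Tree L → L × Tree L → Set

data _≅E_ {L} where
  edge : ∀ {l l' t u} → l ≡ l' → t ≅ u → (l , t) ≅E (l' , u)

data _≅_ {L} where
  node : ∀ {cs ds} → Permutation _≅E_ cs ds → node cs ≅ node ds

-- All edge subsets of a forest, as markings of each edge by a Bool
-- (true = the edge belongs to the subset e).

marksT  : ∀ {L} → Tree L → List (Tree (L × Bool))
marksCs : ∀ {L} → List (L × Tree L) → List (List ((L × Bool) × Tree (L × Bool)))
marksT (node cs) = map node (marksCs cs)
marksCs [] = [] ∷ []
marksCs ((l , t) ∷ cs) =
  concatMap (λ t' → concatMap (λ cs' →
      (((l , true) , t') ∷ cs') ∷ (((l , false) , t') ∷ cs') ∷ []) (marksCs cs))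
    (marksT t)

subsetsF : ∀ {L} → Forest L → List (Forest (L × Bool))
subsetsF [] = [] ∷ []
subsetsF (t ∷ ts) = concatMap (λ t' → map (t' ∷_) (subsetsF ts)) (marksT t)

-- Part_e : keep all vertices and the edges of e (marked true); cutting
-- the other edges.  Returns the component of the root and the other
-- components.

partT  : ∀ {L} → Tree (L × Bool) → Tree L × Forest L
partCs : ∀ {L} → List ((L × Bool) × Tree (L × Bool)) → List (L × Tree L) × Forest L
partT (node cs) with partCs cs
... | ks , fs = node ks , fs
partCs [] = [] , []
partCs (((l , true) , t) ∷ cs) with partT t | partCs cs
... | r , f | ks , fs = (l , r) ∷ ks , f ++ fs
partCs (((l , false) , t) ∷ cs) with partT t | partCs cs
... | r , f | ks , fs = ks , r ∷ f ++ fs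

Part : ∀ {L} → Forest (L × Bool) → Forest L
Part [] = []
Part (t ∷ ts) with partT t
... | r , f = r ∷ f ++ Part ts

contT  : ∀ {L} → Tree (L × Bool) → Tree L
contCs : ∀ {L} → List ((L × Bool) × Tree (L × Bool)) → List (L × Tree L)
contT (node cs) = node (contCs cs)
contCs [] = []
contCs (((l , true) , node ds) ∷ cs) = contCs ds ++ contCs cs
contCs (((l , false) , node ds) ∷ cs) = (l , node (contCs ds)) ∷ contCs cs

Cont : ∀ {L} → Forest (L × Bool) → Forest L
Cont = map contT

-- remove one-vertex trees (identified with the unit)
dropTrivial : ∀ {L} → Forest L → Forest L
dropTrivial [] = []
dropTrivial (node [] ∷ ts) = dropTrivial ts
dropTrivial (node (c ∷ cs) ∷ ts) = node (c ∷ cs) ∷ dropTrivial ts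

data Vtx {L : Set} : Tree L → Set
data VtxC {L : Set} : List (L × Tree L) → Set

data Vtx {L} where
  root : ∀ {cs} → Vtx (node cs)
  down : ∀ {cs} → VtxC cs → Vtx (node cs)

data VtxC {L} where
  hereC  : ∀ {l t cs} → Vtx t → VtxC ((l , t) ∷ cs)
  thereC : ∀ {x cs} → VtxC cs → VtxC (x ∷ cs)

rootPath  : ∀ {L} {t : Tree L} → Vtx t → List L
rootPathC : ∀ {L} {cs : List (L × Tree L)} → VtxC cs → List L
rootPath root = []
rootPath (down v) = rootPathC v
rootPathC (hereC {l = l} v) = l ∷ rootPath v
rootPathC (thereC v) = rootPathC v

path  : ∀ {L} {t : Tree L} → Vtx t → Vtx t → List L
pathC : ∀ {L} {cs : List (L × Tree L)} → VtxC cs → VtxC cs → List L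
path root w = rootPath w
path (down v) root = rootPathC v
path (down v) (down w) = pathC v w
pathC (hereC v) (hereC w) = path v w
pathC (hereC {l = l} v) (thereC w) = (l ∷ rootPath v) ++ rootPathC w
pathC (thereC v) (hereC {l = l} w) = rootPathC v ++ (l ∷ rootPath w)
pathC (thereC v) (thereC w) = pathC v w

incident  : ∀ {L} {t : Tree L} → Vtx t → List L
incidentC : ∀ {L} {cs : List (L × Tree L)} → VtxC cs → List L
incident (root {cs = cs}) = map proj₁ cs
incident (down v) = incidentC v
incidentC (hereC {l = l} (root {cs = ds})) = l ∷ map proj₁ ds
incidentC (hereC (down v)) = incidentC v
incidentC (thereC v) = incidentC v

-- Generalized partitions.  A k-tuple (e_1,...,e_k) of pairwise disjoint
-- subsets with union E(F) is encoded as the labelling G of the edges of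
-- F by Fin k (edge in e_i  <->  label i).

blocks : ∀ {D : Set} {k} → List (D × Fin k) → List (Fin k)
blocks = map proj₂

IsGenPartition : {D : Set} → Forest D → (k : ℕ) → Forest (D × Fin k) → Set
IsGenPartition F k G =
    (mapF proj₁ G ≡ F)
  × (1 ≤ k) × (k ≤ nEdges F)
  × (∀ (i : Fin k) → i ∈ blocks (edgesF G))
  -- (2) the edges of each e_i lie in one connected component
  × (∀ (i : Fin k) (m n : Fin (length G))
       → i ∈ blocks (edgesT (lookup G m))
       → i ∈ blocks (edgesT (lookup G n)) → m ≡ n)
  -- (3) path condition
  × (∀ (T : Tree _) → T ∈ G → ∀ (i j : Fin k) (v w : Vtx T)
       → i ∈ blocks (incident v) → i ∈ blocks (incident w)
       → j ∈ blocks (path v w) → ¬ (j ≡ i) → j < i)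

-- Marking of \bar{e_j} = E(F) \ e_j (true = edge not in e_j)
markCompl : {D : Set} {k : ℕ} → Fin k → Forest (D × Fin k) → Forest (D × Bool)
markCompl j = mapF (λ { (d , i) → (d , not (does (i ≟ j))) })

-- Algebraic side, over a commutative ring K (the field is imposed by
-- hypotheses in the statement).  Elements of Sh^D (and of K(D)) are
-- represented by their coefficient functions, with a finite-support
-- hypothesis where needed.

module Alg {c ℓ} (K : CommutativeRing c ℓ) (D : Set) where
  open CommutativeRing K renaming (Carrier to 𝕂)

  Word : Set
  Word = List D

  Sh : Set c
  Sh = Word → 𝕂

  Lin : Set c
  Lin = D → 𝕂

  FinSupp : ∀ {A : Set} → (A → 𝕂) → Set ℓ
  FinSupp {A} f = Σ (List A) λ S → ∀ a → a ∉ S → f a ≈ 0#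

  _≐_ : Sh → Sh → Set ℓ
  f ≐ g = ∀ w → f w ≈ g w

  Σ' : List 𝕂 → 𝕂
  Σ' = foldr _+_ 0#

  oneSh : Sh
  oneSh [] = 1#
  oneSh (_ ∷ _) = 0#

  splits : Word → List (Word × Word)
  splits [] = ([] , []) ∷ []
  splits (d ∷ w) = concatMap (λ { (u , v) → (d ∷ u , v) ∷ (u , d ∷ v) ∷ [] }) (splits w)

  _⧢_ : Sh → Sh → Sh
  (f ⧢ g) w = Σ' (map (λ { (u , v) → f u * g v }) (splits w))

  concatProd : List Lin → Sh
  concatProd [] [] = 1#
  concatProd [] (_ ∷ _) = 0#
  concatProd (f ∷ fs) [] = 0#
  concatProd (f ∷ fs) (d ∷ w) = f d * concatProd fs w

  εCK : Forest D → 𝕂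
  εCK F with nEdges F
  ... | zero = 1#
  ... | suc _ = 0#

  -- φ applied to a forest which is (in C_CK) a tree: remove the
  -- one-vertex trees; the result is a single tree.
  φ-tree : (Tree D → Lin) → Forest D → Lin
  φ-tree φ F with dropTrivial F
  ... | T ∷ [] = φ T
  ... | _ = λ _ → 0#

  term : (Tree D → Lin) → (Σ ℕ λ k → Forest (D × Fin k)) → Sh
  term φ (k , G) = concatProd (map (λ j → φ-tree φ (Cont (markCompl j G))) (allFin k))

  -- φ : span of trees with ≥ 1 edge → K(D), a linear map on
  -- isomorphism classes of trees (values on the one-vertex tree unused)
  IsTreeMap : (Tree D → Lin) → Set ℓ
  IsTreeMap φ = (∀ T → FinSupp (φ T)) × (∀ T U → T ≅ U → ∀ d → φ T d ≈ φ U d)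

  -- Φ : C_CK → Sh is a Hopf (bialgebra) morphism, given on the basis
  -- of forests, with π ∘ Φ ∘ i = φ.
  record IsΦ (φ : Tree D → Lin) (Φ : Forest D → Sh) : Set (c ⊔ ℓ) where
    field
      finSupp   : ∀ F → FinSupp (Φ F)
      iso       : ∀ T U → T ≅ U → Φ (T ∷ []) ≐ Φ (U ∷ [])
      unit      : Φ [] ≐ oneSh
      unit•     : Φ (• ∷ []) ≐ oneSh
      mult      : ∀ F G → Φ (F ++ G) ≐ (Φ F ⧢ Φ G)
      counit    : ∀ F → Φ F [] ≈ εCK F
      comult    : ∀ F u v → Φ F (u ++ v) ≈
                    Σ' (map (λ e → Φ (Part e) u * Φ (Cont e) v) (subsetsF F))
      πΦi       : ∀ T → 1 ≤ nEdges (T ∷ []) → ∀ d → Φ (T ∷ []) (d ∷ []) ≈ φ T d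

module _ {c ℓ} (K : CommutativeRing c ℓ) where
  open CommutativeRing K renaming (Carrier to 𝕂)

  IsField : Set (c ⊔ ℓ)
  IsField = (¬ (1# ≈ 0#)) × (∀ x → ¬ (x ≈ 0#) → Σ 𝕂 λ y → x * y ≈ 1#)

  _×1 : ℕ → 𝕂
  zero ×1 = 0#
  suc n ×1 = 1# + n ×1

  CharZero : Set ℓ
  CharZero = ∀ n → ¬ (suc n ×1 ≈ 0#)

-- Induction on the length of the word.  Splitting off the first letter d, the
-- coproduct gives Φ(F)(d v) = Σ_e Φ(Part_e F)(d) Φ(Cont_e F)(v), and on one
-- letter Φ(G)(d) = φ(G)(d) if G is, up to one-vertex trees, a single tree with
-- edges, and 0 otherwise.  So only edge sets e forming one connected piece
-- contribute, and these are exactly the possible first blocks e₁ of generalized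
-- partitions of F: conditions (2) and (3) for i = 1 say e₁ is connected.  Removing e₁
-- (contracting it and shifting the other indices down) is a bijection between
-- the generalized partitions of F with first block e and those of Cont_e F, and
-- contracting the complement of e₁ yields Part_e F.  Regrouping the sum over
-- generalized partitions by first block and using induction on Cont_e F gives
-- the formula.

module Submission where

open import Defs
open import Algebra.Bundles using (CommutativeRing)
open import Data.Bool using (Bool; true; false; not; _∧_; if_then_else_; T)
import Data.Bool.Properties as BoolP
open import Data.Empty using (⊥; ⊥-elim)
open import Data.Fin using (Fin; zero; suc; toℕ; _<_)
open import Data.Fin.Properties using (_≟_)
import Data.Fin.Properties as FinP
import Data.Fin as Fin
open import Data.List using (List; []; _∷_; _++_; map; length; lookup; foldr; concatMap; mapMaybe; filterᵇ)
open import Data.List.Properties using (∷-injective; ++-conicalˡ; ++-conicalʳ; ++-assoc; ++-identityʳ; map-++; length-map; map-tabulate; tabulate-cong; mapMaybe-++)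
open import Data.List.Membership.Propositional using (_∈_; find; lose)
open import Data.List.Relation.Binary.Subset.Propositional.Properties using (Any-resp-⊆)
open import Data.List.Membership.Propositional.Properties using (∈-filter⁺; ∈-filter⁻; ∈-++⁺ˡ; ∈-++⁺ʳ; ∈-++⁻; ∈-map⁺; ∈-map⁻)
open import Data.List.Relation.Unary.All using (All; []; _∷_)
import Data.List.Relation.Unary.All as All
import Data.List.Relation.Unary.All.Properties as AllP
open import Data.List.Relation.Unary.Any using (Any; here; there; index)
import Data.List.Relation.Unary.Any as Any
import Data.List.Relation.Unary.Any.Properties as AnyP
open import Data.List.Relation.Unary.Unique.Propositional using (Unique)
open import Data.List.Relation.Unary.AllPairs using ([]; _∷_)
import Data.List.Relation.Unary.Unique.Propositional.Properties as UniqueP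
open import Data.Maybe using (Maybe; just; nothing; maybe′; _>>=_)
import Data.Maybe as Maybe
open import Data.Maybe.Properties using (just-injective)
open import Data.Nat using (ℕ; zero; suc; _≤_; s≤s; z≤n)
import Data.Nat as ℕ
open import Data.Nat.Properties using (≮⇒≥; <⇒≢)
import Data.Nat.Properties as NatP
open import Data.Product using (Σ; _×_; _,_; proj₁; proj₂)
open import Data.Product.Properties using (,-injective)
open import Data.Sum using (_⊎_; inj₁; inj₂)
open import Relation.Binary.PropositionalEquality using (_≡_; _≢_; refl; sym; trans; cong; cong₂; subst)
open import Relation.Nullary using (¬_; does; contradiction)
open import Relation.Nullary.Decidable using (T?)
open import Function using (id; _∘_)

++-cancel-≡-length : ∀ {X : Set} (a b : List X) {c d} → length a ≡ length b → a ++ c ≡ b ++ d → a ≡ b × c ≡ d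
++-cancel-≡-length [] [] _ e = refl , e
++-cancel-≡-length (x ∷ a) (y ∷ b) l e with ∷-injective e
... | refl , e′ with ++-cancel-≡-length a b (NatP.suc-injective l) e′
...   | refl , e″ = refl , e″

++≡[] : ∀ {X : Set} (xs ys : List X) → xs ++ ys ≡ [] → xs ≡ [] × ys ≡ []
++≡[] xs ys e = ++-conicalˡ xs ys e , ++-conicalʳ xs ys e

++≡[x] : ∀ {X : Set} (xs ys : List X) {T} → xs ++ ys ≡ T ∷ [] → (xs ≡ [] × ys ≡ T ∷ []) ⊎ (xs ≡ T ∷ [] × ys ≡ [])
++≡[x] [] ys e = inj₁ (refl , e)
++≡[x] (x ∷ []) [] e = inj₂ (e , refl)
++≡[x] (x ∷ []) (y ∷ ys) ()
++≡[x] (x ∷ x' ∷ xs) ys ()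

lookup-map : ∀ {X Y : Set} (g : X → Y) (xs : List X) i → lookup (map g xs) i ≡ g (lookup xs (Fin.cast (length-map g xs) i))
lookup-map g (x ∷ xs) zero = refl
lookup-map g (x ∷ xs) (suc i) = lookup-map g xs i

cast-injective : ∀ {m n} .(eq : m ≡ n) {i j : Fin m} → Fin.cast eq i ≡ Fin.cast eq j → i ≡ j
cast-injective eq {i} {j} e = trans (sym (FinP.cast-involutive (sym eq) eq i)) (trans (cong (Fin.cast (sym eq)) e) (FinP.cast-involutive (sym eq) eq j))

covers⇒≤length : ∀ {n} (xs : List (Fin n)) → (∀ i → i ∈ xs) → n ≤ length xs
covers⇒≤length {n} xs h = ≮⇒≥ lt
  where
  lt : ¬ (length xs ℕ.< n)
  lt l with FinP.pigeonhole l (λ i → index (h i))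
  ... | i , j , i<j , e = <⇒≢ i<j (cong toℕ (trans (AnyP.lookup-index (h i)) (trans (cong (lookup xs) e) (sym (AnyP.lookup-index (h j))))))

All-≢-map⁺ : ∀ {X Y : Set} (f : X → Y) {x} (xs : List X) → (∀ {y} → y ∈ xs → f x ≡ f y → x ≡ y) → All (λ y → ¬ x ≡ y) xs → All (λ y → ¬ f x ≡ y) (map f xs)
All-≢-map⁺ f [] inj [] = []
All-≢-map⁺ f (y ∷ xs) inj (n ∷ ns) = (λ e → n (inj (here refl) e)) ∷ All-≢-map⁺ f xs (λ m → inj (there m)) ns

Unique-map⁺ : ∀ {X Y : Set} (f : X → Y) (xs : List X) → Unique xs → (∀ {x y} → x ∈ xs → y ∈ xs → f x ≡ f y → x ≡ y) → Unique (map f xs)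
Unique-map⁺ f [] u inj = []
Unique-map⁺ f (x ∷ xs) (a ∷ u) inj = All-≢-map⁺ f xs (λ m e → inj (here refl) (there m) e) a ∷ Unique-map⁺ f xs u (λ m1 m2 e → inj (there m1) (there m2) e)

Unique-singleton : ∀ {X : Set} (a : X) (xs : List X) → Unique xs → (∀ {x} → x ∈ xs → x ≡ a) → a ∈ xs → xs ≡ a ∷ []
Unique-singleton a (x ∷ []) u h m = cong (_∷ []) (h (here refl))
Unique-singleton a (x ∷ y ∷ xs) ((n ∷ _) ∷ _) h m = ⊥-elim (n (trans (h (here refl)) (sym (h (there (here refl))))))

-- Contraction of edges

children : ∀ {M : Set} → Tree M → List (M × Tree M)
children (node cs) = cs

graft : ∀ {M : Set} → Maybe M → Tree M → List (M × Tree M) → List (M × Tree M)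
graft nothing t r = children t ++ r
graft (just m) t r = (m , t) ∷ r

contractT : ∀ {L M : Set} → (L → Maybe M) → Tree L → Tree M
contractCs : ∀ {L M : Set} → (L → Maybe M) → List (L × Tree L) → List (M × Tree M)
contractT f (node cs) = node (contractCs f cs)
contractCs f [] = []
contractCs f ((l , t) ∷ cs) = graft (f l) (contractT f t) (contractCs f cs)

graft-++ : ∀ {M : Set} (m : Maybe M) t (r s : List (M × Tree M)) → graft m t (r ++ s) ≡ graft m t r ++ s
graft-++ nothing t r s = sym (++-assoc (children t) r s)
graft-++ (just x) t r s = refl

contractCs-++ : ∀ {L M : Set} (f : L → Maybe M) xs ys → contractCs f (xs ++ ys) ≡ contractCs f xs ++ contractCs f ys
contractCs-++ f [] ys = refl
contractCs-++ f ((l , t) ∷ xs) ys = trans (cong (graft (f l) (contractT f t)) (contractCs-++ f xs ys)) (graft-++ (f l) (contractT f t) (contractCs f xs) (contractCs f ys))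

edgesCs-++ : ∀ {L : Set} (xs ys : List (L × Tree L)) → edgesCs (xs ++ ys) ≡ edgesCs xs ++ edgesCs ys
edgesCs-++ [] ys = refl
edgesCs-++ ((l , t) ∷ xs) ys = trans (cong (λ z → l ∷ (edgesT t ++ z)) (edgesCs-++ xs ys)) (cong (l ∷_) (sym (++-assoc (edgesT t) (edgesCs xs) (edgesCs ys))))

edgesT-contractT : ∀ {L M : Set} (f : L → Maybe M) t → edgesT (contractT f t) ≡ mapMaybe f (edgesT t)
edgesCs-contractCs : ∀ {L M : Set} (f : L → Maybe M) cs → edgesCs (contractCs f cs) ≡ mapMaybe f (edgesCs cs)
edgesT-contractT f (node cs) = edgesCs-contractCs f cs
edgesCs-contractCs f [] = refl
edgesCs-contractCs f ((l , node ds) ∷ cs) with f l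
... | nothing = trans (edgesCs-++ (contractCs f ds) (contractCs f cs))
                 (trans (cong₂ _++_ (edgesCs-contractCs f ds) (edgesCs-contractCs f cs)) (sym (mapMaybe-++ f (edgesCs ds) (edgesCs cs))))
... | just m = cong (m ∷_) (trans (cong₂ _++_ (edgesCs-contractCs f ds) (edgesCs-contractCs f cs)) (sym (mapMaybe-++ f (edgesCs ds) (edgesCs cs))))

contractT-∘ : ∀ {L M N : Set} (f : L → Maybe M) (g : M → Maybe N) t → contractT g (contractT f t) ≡ contractT (λ l → f l >>= g) t
contractCs-∘ : ∀ {L M N : Set} (f : L → Maybe M) (g : M → Maybe N) cs → contractCs g (contractCs f cs) ≡ contractCs (λ l → f l >>= g) cs
contractT-∘ f g (node cs) = cong node (contractCs-∘ f g cs)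
contractCs-∘ f g [] = refl
contractCs-∘ f g ((l , node ds) ∷ cs) with f l
... | nothing = trans (contractCs-++ g (contractCs f ds) (contractCs f cs)) (cong₂ _++_ (contractCs-∘ f g ds) (contractCs-∘ f g cs))
... | just m = cong₂ (graft (g m)) (cong node (contractCs-∘ f g ds)) (contractCs-∘ f g cs)

contractT-cong : ∀ {L M : Set} (f g : L → Maybe M) → (∀ l → f l ≡ g l) → ∀ t → contractT f t ≡ contractT g t
contractCs-cong : ∀ {L M : Set} (f g : L → Maybe M) → (∀ l → f l ≡ g l) → ∀ cs → contractCs f cs ≡ contractCs g cs
contractT-cong f g e (node cs) = cong node (contractCs-cong f g e cs)
contractCs-cong f g e [] = refl
contractCs-cong f g e ((l , t) ∷ cs) rewrite e l = cong₂ (graft (g l)) (contractT-cong f g e t) (contractCs-cong f g e cs)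

mapT-contractT : ∀ {L M N : Set} (f : L → Maybe M) (g : M → N) t → mapT g (contractT f t) ≡ contractT (λ l → Maybe.map g (f l)) t
mapCs-contractCs : ∀ {L M N : Set} (f : L → Maybe M) (g : M → N) cs → mapCs g (contractCs f cs) ≡ contractCs (λ l → Maybe.map g (f l)) cs
mapCs-++ : ∀ {L M : Set} (g : L → M) xs ys → mapCs g (xs ++ ys) ≡ mapCs g xs ++ mapCs g ys
mapCs-++ g [] ys = refl
mapCs-++ g ((l , t) ∷ xs) ys = cong (_ ∷_) (mapCs-++ g xs ys)
mapT-contractT f g (node cs) = cong node (mapCs-contractCs f g cs)
mapCs-contractCs f g [] = refl
mapCs-contractCs f g ((l , node ds) ∷ cs) with f l
... | nothing = trans (mapCs-++ g (contractCs f ds) (contractCs f cs)) (cong₂ _++_ (mapCs-contractCs f g ds) (mapCs-contractCs f g cs))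
... | just m = cong₂ (λ a b → (g m , node a) ∷ b) (mapCs-contractCs f g ds) (mapCs-contractCs f g cs)

contractT-mapT : ∀ {K L M : Set} (h : K → L) (f : L → Maybe M) t → contractT f (mapT h t) ≡ contractT (λ k → f (h k)) t
contractCs-mapCs : ∀ {K L M : Set} (h : K → L) (f : L → Maybe M) cs → contractCs f (mapCs h cs) ≡ contractCs (λ k → f (h k)) cs
contractT-mapT h f (node cs) = cong node (contractCs-mapCs h f cs)
contractCs-mapCs h f [] = refl
contractCs-mapCs h f ((l , t) ∷ cs) = cong₂ (graft (f (h l))) (contractT-mapT h f t) (contractCs-mapCs h f cs)

keepUnmarked : ∀ {L : Set} → L × Bool → Maybe L
keepUnmarked (l , true) = nothing
keepUnmarked (l , false) = just l

contT-contractT : ∀ {L : Set} (t : Tree (L × Bool)) → contT t ≡ contractT keepUnmarked t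
contCs-contractCs : ∀ {L : Set} (cs : List ((L × Bool) × Tree (L × Bool))) → contCs cs ≡ contractCs keepUnmarked cs
contT-contractT (node cs) = cong node (contCs-contractCs cs)
contCs-contractCs [] = refl
contCs-contractCs (((l , true) , node ds) ∷ cs) = cong₂ _++_ (contCs-contractCs ds) (contCs-contractCs cs)
contCs-contractCs (((l , false) , node ds) ∷ cs) = cong₂ (λ a b → (l , node a) ∷ b) (contCs-contractCs ds) (contCs-contractCs cs)

edgesT-mapT : ∀ {L M : Set} (g : L → M) t → edgesT (mapT g t) ≡ map g (edgesT t)
edgesCs-mapCs : ∀ {L M : Set} (g : L → M) cs → edgesCs (mapCs g cs) ≡ map g (edgesCs cs)
edgesT-mapT g (node cs) = edgesCs-mapCs g cs
edgesCs-mapCs g [] = refl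
edgesCs-mapCs g ((l , t) ∷ cs) = cong (g l ∷_) (trans (cong₂ _++_ (edgesT-mapT g t) (edgesCs-mapCs g cs)) (sym (map-++ g (edgesT t) (edgesCs cs))))

edgesF-mapF : ∀ {L M : Set} (g : L → M) F → edgesF (mapF g F) ≡ map g (edgesF F)
edgesF-mapF g [] = refl
edgesF-mapF g (t ∷ ts) = trans (cong₂ _++_ (edgesT-mapT g t) (edgesF-mapF g ts)) (sym (map-++ g (edgesT t) (edgesF ts)))

mapT-∘ : ∀ {K L M : Set} (g : K → L) (h : L → M) t → mapT h (mapT g t) ≡ mapT (λ x → h (g x)) t
mapCs-∘ : ∀ {K L M : Set} (g : K → L) (h : L → M) cs → mapCs h (mapCs g cs) ≡ mapCs (λ x → h (g x)) cs
mapT-∘ g h (node cs) = cong node (mapCs-∘ g h cs)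
mapCs-∘ g h [] = refl
mapCs-∘ g h ((l , t) ∷ cs) = cong₂ (λ a b → (h (g l) , a) ∷ b) (mapT-∘ g h t) (mapCs-∘ g h cs)

mapT-cong : ∀ {L M : Set} (g h : L → M) → (∀ x → g x ≡ h x) → ∀ t → mapT g t ≡ mapT h t
mapCs-cong : ∀ {L M : Set} (g h : L → M) → (∀ x → g x ≡ h x) → ∀ cs → mapCs g cs ≡ mapCs h cs
mapT-cong g h e (node cs) = cong node (mapCs-cong g h e cs)
mapCs-cong g h e [] = refl
mapCs-cong g h e ((l , t) ∷ cs) = cong₂ _∷_ (cong₂ _,_ (e l) (mapT-cong g h e t)) (mapCs-cong g h e cs)

-- Vertices and paths

module _ {L : Set} where
  injˡ : ∀ {xs ys : List (L × Tree L)} → VtxC xs → VtxC (xs ++ ys)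
  injˡ (hereC v) = hereC v
  injˡ (thereC c) = thereC (injˡ c)
  injʳ : ∀ (xs : List (L × Tree L)) {ys} → VtxC ys → VtxC (xs ++ ys)
  injʳ [] c = c
  injʳ (x ∷ xs) c = thereC (injʳ xs c)
  liftˡ : ∀ {xs ys : List (L × Tree L)} → Vtx (node xs) → Vtx (node (xs ++ ys))
  liftˡ root = root
  liftˡ (down c) = down (injˡ c)
  liftʳ : ∀ (xs : List (L × Tree L)) {ys} → Vtx (node ys) → Vtx (node (xs ++ ys))
  liftʳ xs root = root
  liftʳ xs (down c) = down (injʳ xs c)
  lift∷ : ∀ {x : L × Tree L} {ys} → Vtx (node ys) → Vtx (node (x ∷ ys))
  lift∷ root = root
  lift∷ (down c) = down (thereC c)

  splitVtxC : ∀ (xs : List (L × Tree L)) {ys} (c : VtxC (xs ++ ys)) → (Σ (VtxC xs) λ a → c ≡ injˡ a) ⊎ (Σ (VtxC ys) λ b → c ≡ injʳ xs b)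
  splitVtxC [] c = inj₂ (c , refl)
  splitVtxC (x ∷ xs) (hereC v) = inj₁ (hereC v , refl)
  splitVtxC (x ∷ xs) (thereC c) with splitVtxC xs c
  ... | inj₁ (a , refl) = inj₁ (thereC a , refl)
  ... | inj₂ (b , refl) = inj₂ (b , refl)

  rootPathC-injˡ : ∀ {xs ys : List (L × Tree L)} (c : VtxC xs) → rootPathC (injˡ {xs} {ys} c) ≡ rootPathC c
  rootPathC-injˡ (hereC v) = refl
  rootPathC-injˡ (thereC c) = rootPathC-injˡ c
  rootPathC-injʳ : ∀ (xs : List (L × Tree L)) {ys} (c : VtxC ys) → rootPathC (injʳ xs c) ≡ rootPathC c
  rootPathC-injʳ [] c = refl
  rootPathC-injʳ (x ∷ xs) c = rootPathC-injʳ xs c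
  rootPath-liftˡ : ∀ {xs ys : List (L × Tree L)} (v : Vtx (node xs)) → rootPath (liftˡ {xs} {ys} v) ≡ rootPath v
  rootPath-liftˡ root = refl
  rootPath-liftˡ (down c) = rootPathC-injˡ c
  rootPath-liftʳ : ∀ (xs : List (L × Tree L)) {ys} (v : Vtx (node ys)) → rootPath (liftʳ xs v) ≡ rootPath v
  rootPath-liftʳ xs root = refl
  rootPath-liftʳ xs (down c) = rootPathC-injʳ xs c
  rootPath-lift∷ : ∀ {x : L × Tree L} {ys} (v : Vtx (node ys)) → rootPath (lift∷ {x} v) ≡ rootPath v
  rootPath-lift∷ root = refl
  rootPath-lift∷ (down c) = refl

  path-to-root : ∀ {cs : List (L × Tree L)} (v : Vtx (node cs)) → path v root ≡ rootPath v
  path-to-root root = refl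
  path-to-root (down c) = refl

  pathC-injˡ : ∀ {xs ys : List (L × Tree L)} (a b : VtxC xs) → pathC (injˡ {xs} {ys} a) (injˡ b) ≡ pathC a b
  pathC-injˡ (hereC v) (hereC w) = refl
  pathC-injˡ (hereC {l = l} v) (thereC b) = cong ((l ∷ rootPath v) ++_) (rootPathC-injˡ b)
  pathC-injˡ (thereC a) (hereC {l = l} w) = cong (_++ (l ∷ rootPath w)) (rootPathC-injˡ a)
  pathC-injˡ (thereC a) (thereC b) = pathC-injˡ a b
  path-liftˡ : ∀ {xs ys : List (L × Tree L)} (a b : Vtx (node xs)) → path (liftˡ {xs} {ys} a) (liftˡ b) ≡ path a b
  path-liftˡ root root = refl
  path-liftˡ root (down b) = rootPathC-injˡ b
  path-liftˡ (down a) root = rootPathC-injˡ a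
  path-liftˡ (down a) (down b) = pathC-injˡ a b
  pathC-injʳ : ∀ (xs : List (L × Tree L)) {ys} (a b : VtxC ys) → pathC (injʳ xs a) (injʳ xs b) ≡ pathC a b
  pathC-injʳ [] a b = refl
  pathC-injʳ (x ∷ xs) a b = pathC-injʳ xs a b
  path-liftʳ : ∀ (xs : List (L × Tree L)) {ys} (a b : Vtx (node ys)) → path (liftʳ xs a) (liftʳ xs b) ≡ path a b
  path-liftʳ xs root root = refl
  path-liftʳ xs root (down b) = rootPathC-injʳ xs b
  path-liftʳ xs (down a) root = rootPathC-injʳ xs a
  path-liftʳ xs (down a) (down b) = pathC-injʳ xs a b
  path-lift∷ : ∀ {x : L × Tree L} {ys} (a b : Vtx (node ys)) → path (lift∷ {x} a) (lift∷ b) ≡ path a b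
  path-lift∷ root root = refl
  path-lift∷ root (down b) = refl
  path-lift∷ (down a) root = refl
  path-lift∷ (down a) (down b) = refl

  pathC-injˡ-injʳ : ∀ (xs : List (L × Tree L)) {ys} (a : VtxC xs) (b : VtxC ys) → pathC (injˡ {xs} {ys} a) (injʳ xs b) ≡ rootPathC a ++ rootPathC b
  pathC-injˡ-injʳ ((l , t) ∷ xs) (hereC v) b = cong ((l ∷ rootPath v) ++_) (rootPathC-injʳ xs b)
  pathC-injˡ-injʳ (x ∷ xs) (thereC a) b = pathC-injˡ-injʳ xs a b
  pathC-injʳ-injˡ : ∀ (xs : List (L × Tree L)) {ys} (a : VtxC xs) (b : VtxC ys) → pathC (injʳ xs b) (injˡ {xs} {ys} a) ≡ rootPathC b ++ rootPathC a
  pathC-injʳ-injˡ ((l , t) ∷ xs) (hereC w) b = cong (_++ (l ∷ rootPath w)) (rootPathC-injʳ xs b)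
  pathC-injʳ-injˡ (x ∷ xs) (thereC a) b = pathC-injʳ-injˡ xs a b
  path-liftˡ-liftʳ : ∀ (xs : List (L × Tree L)) {ys} (a : Vtx (node xs)) (b : Vtx (node ys)) → path (liftˡ {xs} {ys} a) (liftʳ xs b) ≡ rootPath a ++ rootPath b
  path-liftˡ-liftʳ xs root root = refl
  path-liftˡ-liftʳ xs root (down b) = rootPathC-injʳ xs b
  path-liftˡ-liftʳ xs (down a) root = trans (rootPathC-injˡ a) (sym (++-identityʳ _))
  path-liftˡ-liftʳ xs (down a) (down b) = pathC-injˡ-injʳ xs a b
  path-liftʳ-liftˡ : ∀ (xs : List (L × Tree L)) {ys} (a : Vtx (node xs)) (b : Vtx (node ys)) → path (liftʳ xs b) (liftˡ {xs} {ys} a) ≡ rootPath b ++ rootPath a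
  path-liftʳ-liftˡ xs root root = refl
  path-liftʳ-liftˡ xs root (down b) = trans (rootPathC-injʳ xs b) (sym (++-identityʳ _))
  path-liftʳ-liftˡ xs (down a) root = rootPathC-injˡ a
  path-liftʳ-liftˡ xs (down a) (down b) = pathC-injʳ-injˡ xs a b
  path-here-lift∷ : ∀ {m : L} {t : Tree L} {ys} (x : Vtx t) (b : Vtx (node ys)) → path (down (hereC {l = m} {cs = ys} x)) (lift∷ b) ≡ (m ∷ rootPath x) ++ rootPath b
  path-here-lift∷ x root = sym (++-identityʳ _)
  path-here-lift∷ x (down d) = refl
  path-lift∷-here : ∀ {m : L} {t : Tree L} {ys} (x : Vtx t) (b : Vtx (node ys)) → path (lift∷ b) (down (hereC {l = m} {cs = ys} x)) ≡ rootPath b ++ (m ∷ rootPath x)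
  path-lift∷-here x root = refl
  path-lift∷-here x (down d) = refl

  incidentC-injˡ : ∀ {xs ys : List (L × Tree L)} (c : VtxC xs) → incidentC (injˡ {xs} {ys} c) ≡ incidentC c
  incidentC-injˡ (hereC root) = refl
  incidentC-injˡ (hereC (down v)) = refl
  incidentC-injˡ (thereC c) = incidentC-injˡ c
  incidentC-injʳ : ∀ (xs : List (L × Tree L)) {ys} (c : VtxC ys) → incidentC (injʳ xs c) ≡ incidentC c
  incidentC-injʳ [] c = refl
  incidentC-injʳ (x ∷ xs) c = incidentC-injʳ xs c
  incident-liftˡ : ∀ {xs ys : List (L × Tree L)} {y} (a : Vtx (node xs)) → y ∈ incident a → y ∈ incident (liftˡ {xs} {ys} a)
  incident-liftˡ {xs} {ys} root h rewrite map-++ proj₁ xs ys = ∈-++⁺ˡ h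
  incident-liftˡ {xs} {ys} {y} (down c) h = subst (y ∈_) (sym (incidentC-injˡ {xs} {ys} c)) h
  incident-liftʳ : ∀ (xs : List (L × Tree L)) {ys} {y} (a : Vtx (node ys)) → y ∈ incident a → y ∈ incident (liftʳ xs a)
  incident-liftʳ xs {ys} root h rewrite map-++ proj₁ xs ys = ∈-++⁺ʳ (map proj₁ xs) h
  incident-liftʳ xs {ys} {y} (down c) h = subst (y ∈_) (sym (incidentC-injʳ xs c)) h
  incident-lift∷ : ∀ {x : L × Tree L} {ys} {y} (a : Vtx (node ys)) → y ∈ incident a → y ∈ incident (lift∷ {x} a)
  incident-lift∷ root h = there h
  incident-lift∷ (down c) h = h
  incident-here : ∀ {m : L} {t : Tree L} {ys} {y} (z : Vtx t) → y ∈ incident z → y ∈ incident (down (hereC {l = m} {cs = ys} z))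
  incident-here {t = node ds} root h = there h
  incident-here (down c) h = h

module VertexProjection {L M : Set} (f : L → Maybe M) where
  πT : ∀ {t : Tree L} → Vtx t → Vtx (contractT f t)
  πH : ∀ {l ds cs} (o : Maybe M) → VtxC ((l , node ds) ∷ cs) → Vtx (node (graft o (node (contractCs f ds)) (contractCs f cs)))
  πC : ∀ {cs : List (L × Tree L)} → VtxC cs → Vtx (node (contractCs f cs))
  πT {node cs} root = root
  πT {node cs} (down c) = πC c
  πH nothing (hereC v) = liftˡ (πT v)
  πH (just m) (hereC v) = down (hereC (πT v))
  πH {ds = ds} nothing (thereC c) = liftʳ (contractCs f ds) (πC c)
  πH (just m) (thereC c) = lift∷ (πC c)
  πC {(l , node ds) ∷ cs} c = πH (f l) c

  rootPath-π : ∀ {t : Tree L} (v : Vtx t) → rootPath (πT v) ≡ mapMaybe f (rootPath v)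
  rootPathC-π : ∀ {cs : List (L × Tree L)} (c : VtxC cs) → rootPath (πC c) ≡ mapMaybe f (rootPathC c)
  rootPath-π {node cs} root = refl
  rootPath-π {node cs} (down c) = rootPathC-π c
  rootPathC-π {(l , node ds) ∷ cs} (hereC v) with f l
  ... | nothing = trans (rootPath-liftˡ (πT v)) (rootPath-π v)
  ... | just m = cong (m ∷_) (rootPath-π v)
  rootPathC-π {(l , node ds) ∷ cs} (thereC c) with f l
  ... | nothing = trans (rootPath-liftʳ (contractCs f ds) (πC c)) (rootPathC-π c)
  ... | just m = trans (rootPath-lift∷ (πC c)) (rootPathC-π c)

  path-π : ∀ {t : Tree L} (v w : Vtx t) → path (πT v) (πT w) ≡ mapMaybe f (path v w)
  pathC-π : ∀ {cs : List (L × Tree L)} (a b : VtxC cs) → path (πC a) (πC b) ≡ mapMaybe f (pathC a b)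
  path-π {node cs} root root = refl
  path-π {node cs} root (down b) = rootPathC-π b
  path-π {node cs} (down a) root = trans (path-to-root (πC a)) (rootPathC-π a)
  path-π {node cs} (down a) (down b) = pathC-π a b
  pathC-π {(l , node ds) ∷ cs} (hereC v) (hereC w) with f l
  ... | nothing = trans (path-liftˡ (πT v) (πT w)) (path-π v w)
  ... | just m = path-π v w
  pathC-π {(l , node ds) ∷ cs} (hereC v) (thereC b) with f l
  ... | nothing = trans (path-liftˡ-liftʳ (contractCs f ds) (πT v) (πC b)) (trans (cong₂ _++_ (rootPath-π v) (rootPathC-π b)) (sym (mapMaybe-++ f (rootPath v) (rootPathC b))))
  ... | just m = trans (path-here-lift∷ (πT v) (πC b)) (trans (cong₂ (λ x y → (m ∷ x) ++ y) (rootPath-π v) (rootPathC-π b)) (cong (m ∷_) (sym (mapMaybe-++ f (rootPath v) (rootPathC b)))))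
  pathC-π {(l , node ds) ∷ cs} (thereC a) (hereC w) with f l in eq
  ... | nothing = trans (path-liftʳ-liftˡ (contractCs f ds) (πT w) (πC a)) (trans (cong₂ _++_ (rootPathC-π a) (rootPath-π w)) (sym (trans (mapMaybe-++ f (rootPathC a) (l ∷ rootPath w)) (cong (λ z → mapMaybe f (rootPathC a) ++ maybe′ _∷_ id z (mapMaybe f (rootPath w))) eq))))
  ... | just m = trans (path-lift∷-here (πT w) (πC a)) (trans (cong₂ (λ x y → x ++ (m ∷ y)) (rootPathC-π a) (rootPath-π w)) (sym (trans (mapMaybe-++ f (rootPathC a) (l ∷ rootPath w)) (cong (λ z → mapMaybe f (rootPathC a) ++ maybe′ _∷_ id z (mapMaybe f (rootPath w))) eq))))
  pathC-π {(l , node ds) ∷ cs} (thereC a) (thereC b) with f l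
  ... | nothing = trans (path-liftʳ (contractCs f ds) (πC a) (πC b)) (pathC-π a b)
  ... | just m = trans (path-lift∷ (πC a) (πC b)) (pathC-π a b)

  ∈-labels-++ˡ : ∀ {A B : Set} {y : A} (xs ys : List (A × B)) → y ∈ map proj₁ xs → y ∈ map proj₁ (xs ++ ys)
  ∈-labels-++ˡ xs ys h rewrite map-++ proj₁ xs ys = ∈-++⁺ˡ h
  ∈-labels-++ʳ : ∀ {A B : Set} {y : A} (xs ys : List (A × B)) → y ∈ map proj₁ ys → y ∈ map proj₁ (xs ++ ys)
  ∈-labels-++ʳ xs ys h rewrite map-++ proj₁ xs ys = ∈-++⁺ʳ (map proj₁ xs) h
  ∈-labels-++⁻ : ∀ {A B : Set} {y : A} (xs : List (A × B)) {ys} → y ∈ map proj₁ (xs ++ ys) → y ∈ map proj₁ xs ⊎ y ∈ map proj₁ ys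
  ∈-labels-++⁻ xs {ys} h rewrite map-++ proj₁ xs ys = ∈-++⁻ (map proj₁ xs) h

  labels-contractCs : ∀ (cs : List (L × Tree L)) {y x} → y ∈ map proj₁ cs → f y ≡ just x → x ∈ map proj₁ (contractCs f cs)
  labels-contractCs ((l , node ds) ∷ cs) (here refl) e with f l
  labels-contractCs ((l , node ds) ∷ cs) (here refl) () | nothing
  ... | just m = here (sym (just-injective e))
  labels-contractCs ((l , node ds) ∷ cs) (there h) e with f l
  ... | nothing = ∈-labels-++ʳ (contractCs f ds) (contractCs f cs) (labels-contractCs cs h e)
  ... | just m = there (labels-contractCs cs h e)

  incident-π : ∀ {t : Tree L} (v : Vtx t) {y x} → y ∈ incident v → f y ≡ just x → x ∈ incident (πT v)
  incidentC-π : ∀ {cs : List (L × Tree L)} (c : VtxC cs) {y x} → y ∈ incidentC c → f y ≡ just x → x ∈ incident (πC c)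
  incident-π {node cs} root h e = labels-contractCs cs h e
  incident-π {node cs} (down c) h e = incidentC-π c h e
  incidentC-π {(l , node ds) ∷ cs} (hereC root) (here refl) e with f l
  incidentC-π {(l , node ds) ∷ cs} (hereC root) (here refl) () | nothing
  ... | just m = here (sym (just-injective e))
  incidentC-π {(l , node ds) ∷ cs} (hereC root) (there h) e with f l
  ... | nothing = ∈-labels-++ˡ (contractCs f ds) (contractCs f cs) (labels-contractCs ds h e)
  ... | just m = there (labels-contractCs ds h e)
  incidentC-π {(l , node ds) ∷ cs} (hereC (down c)) h e with f l
  ... | nothing = incident-liftˡ (πC c) (incidentC-π c h e)
  ... | just m = incident-here (πC c) (incidentC-π c h e)
  incidentC-π {(l , node ds) ∷ cs} (thereC c) h e with f l
  ... | nothing = incident-liftʳ (contractCs f ds) (πC c) (incidentC-π c h e)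
  ... | just m = incident-lift∷ (πC c) (incidentC-π c h e)

  LabelPreimage : ∀ (cs : List (L × Tree L)) → M → Set
  LabelPreimage cs x = (Σ L λ y → y ∈ map proj₁ cs × f y ≡ just x) ⊎ (Σ (VtxC cs) λ c → πC c ≡ root × Σ L λ y → y ∈ incidentC c × f y ≡ just x)

  labels-π⁻¹ : ∀ (cs : List (L × Tree L)) {x} → x ∈ map proj₁ (contractCs f cs) → LabelPreimage cs x
  labels-π⁻¹ ((l , node ds) ∷ cs) {x} h with f l in eq
  ... | nothing with ∈-labels-++⁻ (contractCs f ds) h
  ...   | inj₁ h1 with labels-π⁻¹ ds h1
  ...     | inj₁ (y , yin , fy) = inj₂ (hereC root , refl , y , there yin , fy)
  ...     | inj₂ (c , pc , y , yin , fy) = inj₂ (hereC (down c) , cong liftˡ pc , y , yin , fy)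
  labels-π⁻¹ ((l , node ds) ∷ cs) {x} h | nothing | inj₂ h2 with labels-π⁻¹ cs h2
  ...     | inj₁ (y , yin , fy) = inj₁ (y , there yin , fy)
  ...     | inj₂ (c , pc , rest) = inj₂ (thereC c , cong (liftʳ (contractCs f ds)) pc , rest)
  labels-π⁻¹ ((l , node ds) ∷ cs) {x} (here refl) | just m = inj₁ (l , here refl , eq)
  labels-π⁻¹ ((l , node ds) ∷ cs) {x} (there h) | just m with labels-π⁻¹ cs h
  ...     | inj₁ (y , yin , fy) = inj₁ (y , there yin , fy)
  ...     | inj₂ (c , pc , rest) = inj₂ (thereC c , cong lift∷ pc , rest)

  IncidentPreimageC : ∀ (cs : List (L × Tree L)) → Vtx (node (contractCs f cs)) → M → Set
  IncidentPreimageC cs v' x = Σ (VtxC cs) λ c → πC c ≡ v' × Σ L λ y → y ∈ incidentC c × f y ≡ just x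

  incidentC-π⁻¹ : ∀ (cs : List (L × Tree L)) {x} (c' : VtxC (contractCs f cs)) → x ∈ incidentC c' → IncidentPreimageC cs (down c') x
  incidentC-π⁻¹ ((l , node ds) ∷ cs) {x} c' h with f l in eq
  ... | nothing with splitVtxC (contractCs f ds) c'
  ...   | inj₁ (a , refl) with incidentC-π⁻¹ ds a (subst (x ∈_) (incidentC-injˡ a) h)
  ...     | (c0 , pc , rest) = hereC (down c0) , cong liftˡ pc , rest
  incidentC-π⁻¹ ((l , node ds) ∷ cs) {x} c' h | nothing | inj₂ (b , refl) with incidentC-π⁻¹ cs b (subst (x ∈_) (incidentC-injʳ (contractCs f ds) b) h)
  ...     | (c0 , pc , rest) = thereC c0 , cong (liftʳ (contractCs f ds)) pc , rest
  incidentC-π⁻¹ ((l , node ds) ∷ cs) {x} (hereC root) (here refl) | just m = hereC root , refl , l , here refl , eq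
  incidentC-π⁻¹ ((l , node ds) ∷ cs) {x} (hereC root) (there h) | just m with labels-π⁻¹ ds h
  ...     | inj₁ (y , yin , fy) = hereC root , refl , y , there yin , fy
  ...     | inj₂ (c0 , pc , rest) = hereC (down c0) , cong (λ z → down (hereC z)) pc , rest
  incidentC-π⁻¹ ((l , node ds) ∷ cs) {x} (hereC (down z)) h | just m with incidentC-π⁻¹ ds z h
  ...     | (c0 , pc , rest) = hereC (down c0) , cong (λ z → down (hereC z)) pc , rest
  incidentC-π⁻¹ ((l , node ds) ∷ cs) {x} (thereC b) h | just m with incidentC-π⁻¹ cs b h
  ...     | (c0 , pc , rest) = thereC c0 , cong lift∷ pc , rest

  incident-π⁻¹ : ∀ {t : Tree L} (v' : Vtx (contractT f t)) {x} → x ∈ incident v' → Σ (Vtx t) λ v → πT v ≡ v' × Σ L λ y → y ∈ incident v × f y ≡ just x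
  incident-π⁻¹ {node cs} root h with labels-π⁻¹ cs h
  ... | inj₁ (y , yin , fy) = root , refl , y , yin , fy
  ... | inj₂ (c , pc , rest) = down c , pc , rest
  incident-π⁻¹ {node cs} (down c') h with incidentC-π⁻¹ cs c' h
  ... | (c , pc , rest) = down c , pc , rest

labels⊆edges : ∀ {L : Set} (cs : List (L × Tree L)) {y} → y ∈ map proj₁ cs → y ∈ edgesCs cs
labels⊆edges ((l , t) ∷ cs) (here refl) = here refl
labels⊆edges ((l , t) ∷ cs) (there m) = there (∈-++⁺ʳ (edgesT t) (labels⊆edges cs m))

incidentC⊆edgesCs : ∀ {L : Set} {cs : List (L × Tree L)} (c : VtxC cs) {y} → y ∈ incidentC c → y ∈ edgesCs cs
incidentC⊆edgesCs (hereC {t = node ds} root) (here refl) = here refl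
incidentC⊆edgesCs (hereC {t = node ds} root) (there m) = there (∈-++⁺ˡ (labels⊆edges ds m))
incidentC⊆edgesCs (hereC {t = node ds} (down c)) m = there (∈-++⁺ˡ (incidentC⊆edgesCs c m))
incidentC⊆edgesCs (thereC {x = (l , t)} c) m = there (∈-++⁺ʳ (edgesT t) (incidentC⊆edgesCs c m))

incidentC-hereC⊆edges : ∀ {L : Set} {l : L} {t : Tree L} {cs} (v : Vtx t) {y} → y ∈ incidentC (hereC {l = l} {cs = cs} v) → y ∈ l ∷ edgesT t
incidentC-hereC⊆edges {t = node ds} root (here refl) = here refl
incidentC-hereC⊆edges {t = node ds} root (there m) = there (labels⊆edges ds m)
incidentC-hereC⊆edges {t = node ds} (down c) m = there (incidentC⊆edgesCs c m)

incident⊆edgesT : ∀ {L : Set} {t : Tree L} (v : Vtx t) {y} → y ∈ incident v → y ∈ edgesT t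
incident⊆edgesT {t = node cs} root m = labels⊆edges cs m
incident⊆edgesT {t = node cs} (down c) m = incidentC⊆edgesCs c m

edgesCs⊆incidentC : ∀ {L : Set} (cs : List (L × Tree L)) {y} → y ∈ edgesCs cs → Σ (VtxC cs) λ c → y ∈ incidentC c
edgesCs⊆incidentC ((l , node ds) ∷ cs) (here refl) = hereC root , here refl
edgesCs⊆incidentC ((l , node ds) ∷ cs) (there m) with ∈-++⁻ (edgesCs ds) m
... | inj₁ m1 with edgesCs⊆incidentC ds m1
...   | c , h = hereC (down c) , h
edgesCs⊆incidentC ((l , node ds) ∷ cs) (there m) | inj₂ m2 with edgesCs⊆incidentC cs m2
...   | c , h = thereC c , h

edgesT⊆incident : ∀ {L : Set} (t : Tree L) {y} → y ∈ edgesT t → Σ (Vtx t) λ v → y ∈ incident v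
edgesT⊆incident (node cs) m with edgesCs⊆incidentC cs m
... | c , h = down c , h

All-path : ∀ {L : Set} {P : L → Set} {t : Tree L} (v w : Vtx t) → All P (rootPath v) → All P (rootPath w) → All P (path v w)
All-pathC : ∀ {L : Set} {P : L → Set} {cs : List (L × Tree L)} (a b : VtxC cs) → All P (rootPathC a) → All P (rootPathC b) → All P (pathC a b)
All-path root w pv pw = pw
All-path (down a) root pv pw = pv
All-path (down a) (down b) pv pw = All-pathC a b pv pw
All-pathC (hereC v) (hereC w) (_ ∷ pv) (_ ∷ pw) = All-path v w pv pw
All-pathC (hereC v) (thereC b) pv pw = AllP.++⁺ pv pw
All-pathC (thereC a) (hereC w) pv pw = AllP.++⁺ pv pw
All-pathC (thereC a) (thereC b) pv pw = All-pathC a b pv pw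

-- Connected sets of marked edges

module MarkedEdges {L : Set} (p : L → Bool) where
  Marked : L → Set
  Marked l = p l ≡ true
  Unmarked : L → Set
  Unmarked l = p l ≡ false

  any-marked-or-all-unmarked : ∀ (xs : List L) → Any Marked xs ⊎ All Unmarked xs
  any-marked-or-all-unmarked [] = inj₂ []
  any-marked-or-all-unmarked (x ∷ xs) with p x in eq | any-marked-or-all-unmarked xs
  ... | true | _ = inj₁ (here eq)
  ... | false | inj₁ a = inj₁ (there a)
  ... | false | inj₂ z = inj₂ (eq ∷ z)

  marked-unmarked-⊥ : ∀ {l} → p l ≡ true → p l ≡ false → ⊥
  marked-unmarked-⊥ e1 e2 with trans (sym e1) e2
  ... | ()

  any-marked-all-unmarked-⊥ : ∀ {xs} → Any Marked xs → All Unmarked xs → ⊥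
  any-marked-all-unmarked-⊥ (here t) (f ∷ _) = marked-unmarked-⊥ t f
  any-marked-all-unmarked-⊥ (there a) (_ ∷ fs) = any-marked-all-unmarked-⊥ a fs

  UnmarkedT : Tree L → Set
  UnmarkedT t = All Unmarked (edgesT t)
  UnmarkedCs : List (L × Tree L) → Set
  UnmarkedCs cs = All Unmarked (edgesCs cs)
  UnmarkedF : Forest L → Set
  UnmarkedF ts = All Unmarked (edgesF ts)

  HasMarkedLabel : List (L × Tree L) → Set
  HasMarkedLabel cs = Any Marked (map proj₁ cs)

  data RootedCs : List (L × Tree L) → Set where
    []ʳ : RootedCs []
    marked∷ : ∀ {l ds cs} → p l ≡ true → RootedCs ds → RootedCs cs → RootedCs ((l , node ds) ∷ cs)
    unmarked∷ : ∀ {l t cs} → p l ≡ false → UnmarkedT t → RootedCs cs → RootedCs ((l , t) ∷ cs)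

  -- The marked edges form a nonempty connected subgraph: atRoot if it contains the root
  -- (RootedCs: every marked edge hangs from the root or from a marked edge), below if it lies
  -- in a single child subtree.
  data ConnectedT : Tree L → Set
  data ConnectedBelow : List (L × Tree L) → Set
  data ConnectedT where
    atRoot : ∀ {cs} → RootedCs cs → HasMarkedLabel cs → ConnectedT (node cs)
    below : ∀ {cs} → ConnectedBelow cs → ConnectedT (node cs)
  data ConnectedBelow where
    hereB : ∀ {l t cs} → p l ≡ false → ConnectedT t → UnmarkedCs cs → ConnectedBelow ((l , t) ∷ cs)
    thereB : ∀ {l t cs} → p l ≡ false → UnmarkedT t → ConnectedBelow cs → ConnectedBelow ((l , t) ∷ cs)

  data ConnectedF : Forest L → Set where
    hereF : ∀ {t ts} → ConnectedT t → UnmarkedF ts → ConnectedF (t ∷ ts)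
    thereF : ∀ {t ts} → UnmarkedT t → ConnectedF ts → ConnectedF (t ∷ ts)

  PathClosed : Tree L → Set
  PathClosed t = ∀ (v w : Vtx t) → Any Marked (incident v) → Any Marked (incident w) → All Marked (path v w)

  InOneTree : Forest L → Set
  InOneTree G = ∀ (m n : Fin (length G)) → Any Marked (edgesT (lookup G m)) → Any Marked (edgesT (lookup G n)) → m ≡ n

  ¬incident-hereC : ∀ {l t cs} (v : Vtx t) → p l ≡ false → UnmarkedT t → Any Marked (incidentC (hereC {l = l} {cs = cs} v)) → ⊥
  ¬incident-hereC v pl zt a with find a
  ... | y , m , py with incidentC-hereC⊆edges v m
  ...   | here refl = marked-unmarked-⊥ py pl
  ...   | there m2 = marked-unmarked-⊥ py (All.lookup zt m2)

  ¬incidentC : ∀ {cs} (c : VtxC cs) → UnmarkedCs cs → Any Marked (incidentC c) → ⊥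
  ¬incidentC c z a with find a
  ... | y , m , py = marked-unmarked-⊥ py (All.lookup z (incidentC⊆edgesCs c m))

  ¬incident : ∀ {t} (v : Vtx t) → UnmarkedT t → Any Marked (incident v) → ⊥
  ¬incident v z a with find a
  ... | y , m , py = marked-unmarked-⊥ py (All.lookup z (incident⊆edgesT v m))

  incident-hereC : ∀ {l t cs} (v : Vtx t) → p l ≡ false → Any Marked (incidentC (hereC {l = l} {cs = cs} v)) → Any Marked (incident v)
  incident-hereC {t = node ds} root pl (here t) = ⊥-elim (marked-unmarked-⊥ t pl)
  incident-hereC {t = node ds} root pl (there a) = a
  incident-hereC {t = node ds} (down c) pl a = a

  unmarked⇒pathClosed : ∀ {t} → UnmarkedT t → PathClosed t
  unmarked⇒pathClosed z v w a b = ⊥-elim (¬incident v z a)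

  rootPathC-marked : ∀ {cs} → RootedCs cs → (c : VtxC cs) → Any Marked (incidentC c) → All Marked (rootPathC c)
  rootPathC-marked (marked∷ pl td tc) (hereC root) h = pl ∷ []
  rootPathC-marked (marked∷ pl td tc) (hereC (down c)) h = pl ∷ rootPathC-marked td c h
  rootPathC-marked (unmarked∷ pl zt tc) (hereC v) h = ⊥-elim (¬incident-hereC v pl zt h)
  rootPathC-marked (marked∷ pl td tc) (thereC c) h = rootPathC-marked tc c h
  rootPathC-marked (unmarked∷ pl zt tc) (thereC c) h = rootPathC-marked tc c h

  rootPath-marked : ∀ {cs} → RootedCs cs → (v : Vtx (node cs)) → Any Marked (incident v) → All Marked (rootPath v)
  rootPath-marked tc root h = []
  rootPath-marked tc (down c) h = rootPathC-marked tc c h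

  labels-unmarked : ∀ {cs} → UnmarkedCs cs → All Unmarked (map proj₁ cs)
  labels-unmarked {cs} z = All.tabulate (λ m → All.lookup z (labels⊆edges cs m))

  labels-unmarked-below : ∀ {cs} → ConnectedBelow cs → All Unmarked (map proj₁ cs)
  labels-unmarked-below (hereB pl _ z) = pl ∷ labels-unmarked z
  labels-unmarked-below (thereB pl _ cb) = pl ∷ labels-unmarked-below cb

  connected⇒pathClosed : ∀ {t} → ConnectedT t → PathClosed t
  connectedBelow⇒pathClosed : ∀ {cs} → ConnectedBelow cs → (a b : VtxC cs) → Any Marked (incidentC a) → Any Marked (incidentC b) → All Marked (pathC a b)
  connected⇒pathClosed (atRoot tc ht) v w a b = All-path v w (rootPath-marked tc v a) (rootPath-marked tc w b)
  connected⇒pathClosed (below cb) root w a b = ⊥-elim (any-marked-all-unmarked-⊥ a (labels-unmarked-below cb))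
  connected⇒pathClosed (below cb) (down c) root a b = ⊥-elim (any-marked-all-unmarked-⊥ b (labels-unmarked-below cb))
  connected⇒pathClosed (below cb) (down c) (down d) a b = connectedBelow⇒pathClosed cb c d a b
  connectedBelow⇒pathClosed (hereB pl ct z) (hereC v) (hereC w) a b = connected⇒pathClosed ct v w (incident-hereC v pl a) (incident-hereC w pl b)
  connectedBelow⇒pathClosed (hereB pl ct z) (hereC v) (thereC d) a b = ⊥-elim (¬incidentC d z b)
  connectedBelow⇒pathClosed (hereB pl ct z) (thereC c) d a b = ⊥-elim (¬incidentC c z a)
  connectedBelow⇒pathClosed (thereB pl zt cb) (hereC v) d a b = ⊥-elim (¬incident-hereC v pl zt a)
  connectedBelow⇒pathClosed (thereB pl zt cb) (thereC c) (hereC w) a b = ⊥-elim (¬incident-hereC w pl zt b)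
  connectedBelow⇒pathClosed (thereB pl zt cb) (thereC c) (thereC d) a b = connectedBelow⇒pathClosed cb c d a b

  connected⇒any-marked : ∀ {t} → ConnectedT t → Any Marked (edgesT t)
  connectedBelow⇒any-marked : ∀ {cs} → ConnectedBelow cs → Any Marked (edgesCs cs)
  connected⇒any-marked {node cs} (atRoot tc ht) = Any-resp-⊆ (labels⊆edges cs) ht
  connected⇒any-marked (below cb) = connectedBelow⇒any-marked cb
  connectedBelow⇒any-marked (hereB {t = t} pl ct z) = there (Any-resp-⊆ ∈-++⁺ˡ (connected⇒any-marked ct))
  connectedBelow⇒any-marked (thereB {t = t} pl zt cb) = there (Any-resp-⊆ (∈-++⁺ʳ (edgesT t)) (connectedBelow⇒any-marked cb))

  unmarkedF-lookup : ∀ {ts} → UnmarkedF ts → (n : Fin (length ts)) → UnmarkedT (lookup ts n)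
  unmarkedF-lookup {t ∷ ts} z zero = AllP.++⁻ˡ (edgesT t) z
  unmarkedF-lookup {t ∷ ts} z (suc n) = unmarkedF-lookup {ts} (AllP.++⁻ʳ (edgesT t) z) n

  connected⇒inOneTree : ∀ {G} → ConnectedF G → InOneTree G
  connected⇒inOneTree (hereF ct z) zero zero a b = refl
  connected⇒inOneTree (hereF {ts = ts} ct z) zero (suc n) a b = ⊥-elim (any-marked-all-unmarked-⊥ b (unmarkedF-lookup {ts} z n))
  connected⇒inOneTree (hereF {ts = ts} ct z) (suc m) n a b = ⊥-elim (any-marked-all-unmarked-⊥ a (unmarkedF-lookup {ts} z m))
  connected⇒inOneTree (thereF zt c) zero n a b = ⊥-elim (any-marked-all-unmarked-⊥ a zt)
  connected⇒inOneTree (thereF zt c) (suc m) zero a b = ⊥-elim (any-marked-all-unmarked-⊥ b zt)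
  connected⇒inOneTree (thereF zt c) (suc m) (suc n) a b = cong suc (connected⇒inOneTree c m n a b)

  connectedF⇒any-marked : ∀ {G} → ConnectedF G → Any Marked (edgesF G)
  connectedF⇒any-marked (hereF ct z) = Any-resp-⊆ ∈-++⁺ˡ (connected⇒any-marked ct)
  connectedF⇒any-marked (thereF {t = t} zt c) = Any-resp-⊆ (∈-++⁺ʳ (edgesT t)) (connectedF⇒any-marked c)

  connectedF⇒pathClosed : ∀ {G} → ConnectedF G → ∀ T → T ∈ G → PathClosed T
  connectedF⇒pathClosed (hereF ct z) T (here refl) = connected⇒pathClosed ct
  connectedF⇒pathClosed (hereF {t = t} ct z) T (there m) = unmarked⇒pathClosed (zeroFlookupM z m)
    where
    zeroFlookupM : ∀ {ts T} → UnmarkedF ts → T ∈ ts → UnmarkedT T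
    zeroFlookupM {t ∷ ts} z (here refl) = AllP.++⁻ˡ (edgesT t) z
    zeroFlookupM {t ∷ ts} z (there m) = zeroFlookupM (AllP.++⁻ʳ (edgesT t) z) m
  connectedF⇒pathClosed (thereF zt c) T (here refl) = unmarked⇒pathClosed zt
  connectedF⇒pathClosed (thereF zt c) T (there m) = connectedF⇒pathClosed c T m

  rooted-from-rootPaths : ∀ cs → (∀ (c : VtxC cs) → Any Marked (incidentC c) → All Marked (rootPathC c)) → RootedCs cs
  rooted-from-rootPaths [] RP = []ʳ
  rooted-from-rootPaths ((l , node ds) ∷ cs) RP with p l in eq
  ... | true = marked∷ eq (rooted-from-rootPaths ds (λ c h → All.tail (RP (hereC (down c)) h))) (rooted-from-rootPaths cs (λ c h → RP (thereC c) h))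
  ... | false = unmarked∷ eq (All.tabulate zf) (rooted-from-rootPaths cs (λ c h → RP (thereC c) h))
    where
    zf : ∀ {y} → y ∈ edgesCs ds → p y ≡ false
    zf {y} m with p y in ey
    ... | false = refl
    ... | true with edgesCs⊆incidentC ds m
    ...   | c , h = ⊥-elim (marked-unmarked-⊥ (All.head (RP (hereC (down c)) (lose h ey))) eq)

  pathClosed⇒connected : ∀ t → PathClosed t → Any Marked (edgesT t) → ConnectedT t
  pathClosed⇒connectedBelow : ∀ cs → PathClosed (node cs) → Any Marked (edgesCs cs) → ¬ HasMarkedLabel cs → ConnectedBelow cs
  pathClosed⇒connected (node cs) g a with any-marked-or-all-unmarked (map proj₁ cs)
  ... | inj₁ ht = atRoot (rooted-from-rootPaths cs (λ c h → g root (down c) ht h)) ht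
  ... | inj₂ af = below (pathClosed⇒connectedBelow cs g a (λ ht → any-marked-all-unmarked-⊥ ht af))
  pathClosed⇒connectedBelow ((l , t) ∷ cs) g a nh with p l in eq
  ... | true = ⊥-elim (nh (here eq))
  ... | false with any-marked-or-all-unmarked (edgesT t)
  ...   | inj₁ at = hereB eq (pathClosed⇒connected t gchild at) (All.tabulate zr)
    where
    gchild : PathClosed t
    gchild v w a b = g (down (hereC v)) (down (hereC w)) (Any-resp-⊆ (incident-here v) a) (Any-resp-⊆ (incident-here w) b)
    zr : ∀ {y} → y ∈ edgesCs cs → p y ≡ false
    zr {y} m with p y in ey
    ... | false = refl
    ... | true with edgesCs⊆incidentC cs m | find at
    ...   | c , h | y' , m' , py' with edgesT⊆incident t m'
    ...     | v , hv = ⊥-elim (marked-unmarked-⊥ (All.head (g (down (hereC v)) (down (thereC c)) (Any-resp-⊆ (incident-here v) (lose hv py')) (lose h ey))) eq)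
  ...   | inj₂ zt = thereB eq zt (pathClosed⇒connectedBelow cs g' a' (λ ht → nh (there ht)))
    where
    g' : PathClosed (node cs)
    g' v w a b = subst (All Marked) (path-lift∷ v w) (g (lift∷ v) (lift∷ w) (Any-resp-⊆ (incident-lift∷ v) a) (Any-resp-⊆ (incident-lift∷ w) b))
    a' : Any Marked (edgesCs cs)
    a' = a'' a
      where
      a'' : Any Marked (l ∷ edgesT t ++ edgesCs cs) → Any Marked (edgesCs cs)
      a'' (here pt) = ⊥-elim (marked-unmarked-⊥ pt eq)
      a'' (there a2) with find a2
      ... | y , m , py with ∈-++⁻ (edgesT t) m
      ...   | inj₁ m1 = ⊥-elim (marked-unmarked-⊥ py (All.lookup zt m1))
      ...   | inj₂ m2 = lose m2 py

  edgesF-lookup : ∀ (G : Forest L) {y} → y ∈ edgesF G → Σ (Fin (length G)) λ n → y ∈ edgesT (lookup G n)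
  edgesF-lookup (t ∷ ts) m with ∈-++⁻ (edgesT t) m
  ... | inj₁ m1 = zero , m1
  ... | inj₂ m2 with edgesF-lookup ts m2
  ...   | n , h = suc n , h

  pathClosed⇒connectedF : ∀ G → (∀ T → T ∈ G → PathClosed T) → InOneTree G → Any Marked (edgesF G) → ConnectedF G
  pathClosed⇒connectedF (t ∷ ts) g c2 a with any-marked-or-all-unmarked (edgesT t)
  ... | inj₁ at = hereF (pathClosed⇒connected t (g t (here refl)) at) (All.tabulate zr)
    where
    zr : ∀ {y} → y ∈ edgesF ts → p y ≡ false
    zr {y} m with p y in ey
    ... | false = refl
    ... | true with edgesF-lookup ts m
    ...   | n , h with c2 zero (suc n) at (lose h ey)
    ...     | ()
  ... | inj₂ zt = thereF zt (pathClosed⇒connectedF ts (λ T m → g T (there m)) (λ m n a b → sucInj (c2 (suc m) (suc n) a b)) a')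
    where
    sucInj : ∀ {k} {m n : Fin k} → Fin.suc m ≡ suc n → m ≡ n
    sucInj refl = refl
    a' : Any Marked (edgesF ts)
    a' with find a
    ... | y , m , py with ∈-++⁻ (edgesT t) m
    ...   | inj₁ m1 = ⊥-elim (marked-unmarked-⊥ py (All.lookup zt m1))
    ...   | inj₂ m2 = lose m2 py

module Relabel {L L' : Set} (h : L → L') (p : L → Bool) (p' : L' → Bool) (hp : ∀ x → p' (h x) ≡ p x) where
  module Src = MarkedEdges p
  module Tgt = MarkedEdges p'

  all-map⁺ : ∀ {b} (xs : List L) → All (λ x → p x ≡ b) xs → All (λ y → p' y ≡ b) (map h xs)
  all-map⁺ xs z = AllP.map⁺ (All.map (λ {x} e → trans (hp x) e) z)

  all-map⁻ : ∀ {b} (xs : List L) → All (λ y → p' y ≡ b) (map h xs) → All (λ x → p x ≡ b) xs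
  all-map⁻ xs z = All.map (λ {x} e → trans (sym (hp x)) e) (AllP.map⁻ z)

  any-map⁺ : ∀ {b} (xs : List L) → Any (λ x → p x ≡ b) xs → Any (λ y → p' y ≡ b) (map h xs)
  any-map⁺ xs a = AnyP.map⁺ (Any.map (λ {x} e → trans (hp x) e) a)

  any-map⁻ : ∀ {b} (xs : List L) → Any (λ y → p' y ≡ b) (map h xs) → Any (λ x → p x ≡ b) xs
  any-map⁻ xs a = Any.map (λ {x} e → trans (sym (hp x)) e) (AnyP.map⁻ a)

  labels-mapCs : ∀ (cs : List (L × Tree L)) → map proj₁ (mapCs h cs) ≡ map h (map proj₁ cs)
  labels-mapCs [] = refl
  labels-mapCs ((l , t) ∷ cs) = cong (h l ∷_) (labels-mapCs cs)

  unmarkedT⁺ : ∀ t → Src.UnmarkedT t → Tgt.UnmarkedT (mapT h t)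
  unmarkedT⁺ t z = subst (All _) (sym (edgesT-mapT h t)) (all-map⁺ (edgesT t) z)
  unmarkedT⁻ : ∀ t → Tgt.UnmarkedT (mapT h t) → Src.UnmarkedT t
  unmarkedT⁻ t z = all-map⁻ (edgesT t) (subst (All _) (edgesT-mapT h t) z)
  unmarkedCs⁺ : ∀ cs → Src.UnmarkedCs cs → Tgt.UnmarkedCs (mapCs h cs)
  unmarkedCs⁺ cs z = subst (All _) (sym (edgesCs-mapCs h cs)) (all-map⁺ (edgesCs cs) z)
  unmarkedCs⁻ : ∀ cs → Tgt.UnmarkedCs (mapCs h cs) → Src.UnmarkedCs cs
  unmarkedCs⁻ cs z = all-map⁻ (edgesCs cs) (subst (All _) (edgesCs-mapCs h cs) z)
  unmarkedF⁺ : ∀ ts → Src.UnmarkedF ts → Tgt.UnmarkedF (mapF h ts)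
  unmarkedF⁺ ts z = subst (All _) (sym (edgesF-mapF h ts)) (all-map⁺ (edgesF ts) z)
  unmarkedF⁻ : ∀ ts → Tgt.UnmarkedF (mapF h ts) → Src.UnmarkedF ts
  unmarkedF⁻ ts z = all-map⁻ (edgesF ts) (subst (All _) (edgesF-mapF h ts) z)

  rooted⁺ : ∀ {cs} → Src.RootedCs cs → Tgt.RootedCs (mapCs h cs)
  rooted⁺ Src.[]ʳ = Tgt.[]ʳ
  rooted⁺ (Src.marked∷ {l} pl td tc) = Tgt.marked∷ (trans (hp l) pl) (rooted⁺ td) (rooted⁺ tc)
  rooted⁺ (Src.unmarked∷ {l} {t} pl zt tc) = Tgt.unmarked∷ (trans (hp l) pl) (unmarkedT⁺ t zt) (rooted⁺ tc)
  rooted⁻ : ∀ cs → Tgt.RootedCs (mapCs h cs) → Src.RootedCs cs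
  rooted⁻ [] Tgt.[]ʳ = Src.[]ʳ
  rooted⁻ ((l , node ds) ∷ cs) (Tgt.marked∷ pl td tc) = Src.marked∷ (trans (sym (hp l)) pl) (rooted⁻ ds td) (rooted⁻ cs tc)
  rooted⁻ ((l , t) ∷ cs) (Tgt.unmarked∷ pl zt tc) = Src.unmarked∷ (trans (sym (hp l)) pl) (unmarkedT⁻ t zt) (rooted⁻ cs tc)

  marked-label⁺ : ∀ cs → Src.HasMarkedLabel cs → Tgt.HasMarkedLabel (mapCs h cs)
  marked-label⁺ cs a = subst (Any _) (sym (labels-mapCs cs)) (any-map⁺ (map proj₁ cs) a)
  marked-label⁻ : ∀ cs → Tgt.HasMarkedLabel (mapCs h cs) → Src.HasMarkedLabel cs
  marked-label⁻ cs a = any-map⁻ (map proj₁ cs) (subst (Any _) (labels-mapCs cs) a)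

  connectedT⁺ : ∀ {t} → Src.ConnectedT t → Tgt.ConnectedT (mapT h t)
  connectedBelow⁺ : ∀ {cs} → Src.ConnectedBelow cs → Tgt.ConnectedBelow (mapCs h cs)
  connectedT⁺ {node cs} (Src.atRoot tc ht) = Tgt.atRoot (rooted⁺ tc) (marked-label⁺ cs ht)
  connectedT⁺ (Src.below cb) = Tgt.below (connectedBelow⁺ cb)
  connectedBelow⁺ (Src.hereB {l} {t} {cs} pl ct z) = Tgt.hereB (trans (hp l) pl) (connectedT⁺ ct) (unmarkedCs⁺ cs z)
  connectedBelow⁺ (Src.thereB {l} {t} {cs} pl zt cb) = Tgt.thereB (trans (hp l) pl) (unmarkedT⁺ t zt) (connectedBelow⁺ cb)

  connectedT⁻ : ∀ t → Tgt.ConnectedT (mapT h t) → Src.ConnectedT t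
  connectedBelow⁻ : ∀ cs → Tgt.ConnectedBelow (mapCs h cs) → Src.ConnectedBelow cs
  connectedT⁻ (node cs) (Tgt.atRoot tc ht) = Src.atRoot (rooted⁻ cs tc) (marked-label⁻ cs ht)
  connectedT⁻ (node cs) (Tgt.below cb) = Src.below (connectedBelow⁻ cs cb)
  connectedBelow⁻ ((l , t) ∷ cs) (Tgt.hereB pl ct z) = Src.hereB (trans (sym (hp l)) pl) (connectedT⁻ t ct) (unmarkedCs⁻ cs z)
  connectedBelow⁻ ((l , t) ∷ cs) (Tgt.thereB pl zt cb) = Src.thereB (trans (sym (hp l)) pl) (unmarkedT⁻ t zt) (connectedBelow⁻ cs cb)

  connectedF⁺ : ∀ {G} → Src.ConnectedF G → Tgt.ConnectedF (mapF h G)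
  connectedF⁺ (Src.hereF {t} {ts} ct z) = Tgt.hereF (connectedT⁺ ct) (unmarkedF⁺ ts z)
  connectedF⁺ (Src.thereF {t} zt c) = Tgt.thereF (unmarkedT⁺ t zt) (connectedF⁺ c)
  connectedF⁻ : ∀ G → Tgt.ConnectedF (mapF h G) → Src.ConnectedF G
  connectedF⁻ (t ∷ ts) (Tgt.hereF ct z) = Src.hereF (connectedT⁻ t ct) (unmarkedF⁻ ts z)
  connectedF⁻ (t ∷ ts) (Tgt.thereF zt c) = Src.thereF (unmarkedT⁻ t zt) (connectedF⁻ ts c)

-- Part and Cont of a connected edge set

dropTrivial-++ : ∀ {A : Set} (xs ys : Forest A) → dropTrivial (xs ++ ys) ≡ dropTrivial xs ++ dropTrivial ys
dropTrivial-++ [] ys = refl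
dropTrivial-++ (node [] ∷ xs) ys = dropTrivial-++ xs ys
dropTrivial-++ (node (c ∷ cs) ∷ xs) ys = cong (node (c ∷ cs) ∷_) (dropTrivial-++ xs ys)

module _ {A : Set} where
  open MarkedEdges {A × Bool} proj₂

  complementMark : A × Bool → A × Bool
  complementMark (a , b) = (a , not b)

  partT-node : ∀ (cs : List ((A × Bool) × Tree (A × Bool))) → partT (node cs) ≡ (node (proj₁ (partCs cs)) , proj₂ (partCs cs))
  partT-node cs with partCs cs
  ... | ks , fs = refl
  partCs-marked : ∀ a t (cs : List ((A × Bool) × Tree (A × Bool))) → partCs (((a , true) , t) ∷ cs) ≡ ((a , proj₁ (partT t)) ∷ proj₁ (partCs cs) , proj₂ (partT t) ++ proj₂ (partCs cs))
  partCs-marked a t cs with partT t | partCs cs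
  ... | r , f | ks , fs = refl
  partCs-unmarked : ∀ a t (cs : List ((A × Bool) × Tree (A × Bool))) → partCs (((a , false) , t) ∷ cs) ≡ (proj₁ (partCs cs) , proj₁ (partT t) ∷ proj₂ (partT t) ++ proj₂ (partCs cs))
  partCs-unmarked a t cs with partT t | partCs cs
  ... | r , f | ks , fs = refl
  Part-∷ : ∀ (t : Tree (A × Bool)) ts → Part (t ∷ ts) ≡ proj₁ (partT t) ∷ proj₂ (partT t) ++ Part ts
  Part-∷ t ts with partT t
  ... | r , f = refl

  partForestT : Tree (A × Bool) → Forest A
  partForestT t = proj₁ (partT t) ∷ proj₂ (partT t)

  contComplementT : Tree (A × Bool) → Tree A
  contComplementT t = contT (mapT complementMark t)

  dropTrivial-Part-∷ : ∀ (t : Tree (A × Bool)) ts → dropTrivial (Part (t ∷ ts)) ≡ dropTrivial (partForestT t) ++ dropTrivial (Part ts)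
  dropTrivial-Part-∷ t ts rewrite Part-∷ t ts = dropTrivial-++ (partForestT t) (Part ts)

  partForestT-node : ∀ (cs : List ((A × Bool) × Tree (A × Bool))) → partForestT (node cs) ≡ node (proj₁ (partCs cs)) ∷ proj₂ (partCs cs)
  partForestT-node cs rewrite partT-node cs = refl

  unmarked⇒partForestT-trivial : ∀ (t : Tree (A × Bool)) → UnmarkedT t → dropTrivial (partForestT t) ≡ []
  unmarked⇒partCs-trivial : ∀ (cs : List ((A × Bool) × Tree (A × Bool))) → UnmarkedCs cs → proj₁ (partCs cs) ≡ [] × dropTrivial (proj₂ (partCs cs)) ≡ []
  unmarked⇒partForestT-trivial (node cs) z rewrite partForestT-node cs with unmarked⇒partCs-trivial cs z
  ... | e1 , e2 rewrite e1 = e2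
  unmarked⇒partCs-trivial [] z = refl , refl
  unmarked⇒partCs-trivial (((a , true) , t) ∷ cs) (() ∷ z)
  unmarked⇒partCs-trivial (((a , false) , t) ∷ cs) (_ ∷ z) rewrite partCs-unmarked a t cs with unmarked⇒partCs-trivial cs (AllP.++⁻ʳ (edgesT t) z)
  ... | e1 , e2 = e1 , trans (dropTrivial-++ (partForestT t) (proj₂ (partCs cs))) (cong₂ _++_ (unmarked⇒partForestT-trivial t (AllP.++⁻ˡ (edgesT t) z)) e2)

  unmarked⇒contComplementCs-empty : ∀ (cs : List ((A × Bool) × Tree (A × Bool))) → UnmarkedCs cs → contCs (mapCs complementMark cs) ≡ []
  unmarked⇒contComplementCs-empty [] z = refl
  unmarked⇒contComplementCs-empty (((a , true) , t) ∷ cs) (() ∷ z)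
  unmarked⇒contComplementCs-empty (((a , false) , node ds) ∷ cs) (_ ∷ z) = cong₂ _++_ (unmarked⇒contComplementCs-empty ds (AllP.++⁻ˡ (edgesCs ds) z)) (unmarked⇒contComplementCs-empty cs (AllP.++⁻ʳ (edgesCs ds) z))

  unmarked⇒contComplementT-trivial : ∀ (t : Tree (A × Bool)) → UnmarkedT t → contComplementT t ≡ node []
  unmarked⇒contComplementT-trivial (node cs) z = cong node (unmarked⇒contComplementCs-empty cs z)

  unmarked⇒Part-trivial : ∀ (ts : Forest (A × Bool)) → UnmarkedF ts → dropTrivial (Part ts) ≡ []
  unmarked⇒Part-trivial [] z = refl
  unmarked⇒Part-trivial (t ∷ ts) z = trans (dropTrivial-Part-∷ t ts) (cong₂ _++_ (unmarked⇒partForestT-trivial t (AllP.++⁻ˡ (edgesT t) z)) (unmarked⇒Part-trivial ts (AllP.++⁻ʳ (edgesT t) z)))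

  unmarked⇒contComplement-trivial : ∀ (ts : Forest (A × Bool)) → UnmarkedF ts → dropTrivial (Cont (mapF complementMark ts)) ≡ []
  unmarked⇒contComplement-trivial [] z = refl
  unmarked⇒contComplement-trivial (t ∷ ts) z rewrite unmarked⇒contComplementT-trivial t (AllP.++⁻ˡ (edgesT t) z) = unmarked⇒contComplement-trivial ts (AllP.++⁻ʳ (edgesT t) z)

  rooted⇒partCs≡contComplement : ∀ {cs} → RootedCs cs → dropTrivial (proj₂ (partCs cs)) ≡ [] × proj₁ (partCs cs) ≡ contCs (mapCs complementMark cs)
  rooted⇒partCs≡contComplement []ʳ = refl , refl
  rooted⇒partCs≡contComplement (marked∷ {(a , .true)} {ds} {cs} refl td tc) rewrite partCs-marked a (node ds) cs | partT-node ds with rooted⇒partCs≡contComplement td | rooted⇒partCs≡contComplement tc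
  ... | d1 , d2 | c1 , c2 = trans (dropTrivial-++ (proj₂ (partCs ds)) (proj₂ (partCs cs))) (cong₂ _++_ d1 c1) , cong₂ (λ x y → (a , node x) ∷ y) d2 c2
  rooted⇒partCs≡contComplement (unmarked∷ {(a , .false)} {node ds} {cs} refl zt tc) rewrite partCs-unmarked a (node ds) cs with rooted⇒partCs≡contComplement tc
  ... | c1 , c2 = trans (dropTrivial-++ (partForestT (node ds)) (proj₂ (partCs cs))) (cong₂ _++_ (unmarked⇒partForestT-trivial (node ds) zt) c1) , trans c2 (cong (_++ contCs (mapCs complementMark cs)) (sym (unmarked⇒contComplementCs-empty ds zt)))

  marked-label⇒partCs-nonempty : ∀ {cs} → HasMarkedLabel cs → Σ _ λ c → Σ _ λ r → proj₁ (partCs cs) ≡ c ∷ r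
  marked-label⇒partCs-nonempty {((a , true) , t) ∷ cs} h rewrite partCs-marked a t cs = _ , _ , refl
  marked-label⇒partCs-nonempty {((a , false) , t) ∷ cs} (here ()) 
  marked-label⇒partCs-nonempty {((a , false) , t) ∷ cs} (there h) rewrite partCs-unmarked a t cs = marked-label⇒partCs-nonempty h

  SingleNontrivial : Forest A → Tree A → Set
  SingleNontrivial X T1 = Σ _ λ c → Σ _ λ r → (dropTrivial X ≡ node (c ∷ r) ∷ []) × (T1 ≡ node (c ∷ r))

  connected⇒partForestT-single : ∀ {t} → ConnectedT t → SingleNontrivial (partForestT t) (contComplementT t)
  connectedBelow⇒partCs-single : ∀ {cs} → ConnectedBelow cs → proj₁ (partCs cs) ≡ [] × SingleNontrivial (proj₂ (partCs cs)) (node (contCs (mapCs complementMark cs)))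
  connected⇒partForestT-single {node cs} (atRoot tc ht) with marked-label⇒partCs-nonempty ht | rooted⇒partCs≡contComplement tc
  ... | c , r , e | t1 , t2 rewrite partForestT-node cs | e = c , r , cong (node (c ∷ r) ∷_) t1 , cong node (sym t2)
  connected⇒partForestT-single {node cs} (below cb) with connectedBelow⇒partCs-single cb
  ... | e , c , r , d , ct rewrite partForestT-node cs | e = c , r , d , ct
  connectedBelow⇒partCs-single (hereB {(a , .false)} {node ds} {cs} refl ct z) rewrite partCs-unmarked a (node ds) cs with unmarked⇒partCs-trivial cs z | connected⇒partForestT-single ct
  ... | e1 , e2 | c , r , d , cc = e1 , c , r , trans (dropTrivial-++ (partForestT (node ds)) (proj₂ (partCs cs))) (trans (cong₂ _++_ d e2) refl) , trans (cong node (cong₂ _++_ (cong children cc) (unmarked⇒contComplementCs-empty cs z))) (cong node (++-identityʳ (c ∷ r)))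
  connectedBelow⇒partCs-single (thereB {(a , .false)} {node ds} {cs} refl zt cb) rewrite partCs-unmarked a (node ds) cs with connectedBelow⇒partCs-single cb
  ... | e1 , c , r , d , cc = e1 , c , r , trans (dropTrivial-++ (partForestT (node ds)) (proj₂ (partCs cs))) (cong₂ _++_ (unmarked⇒partForestT-trivial (node ds) zt) d) , trans (cong node (cong (_++ contCs (mapCs complementMark cs)) (unmarked⇒contComplementCs-empty ds zt))) cc

  connected⇒Part≡contComplement : ∀ {e} → ConnectedF e → Σ _ λ c → Σ _ λ r → (dropTrivial (Part e) ≡ node (c ∷ r) ∷ []) × (dropTrivial (Cont (mapF complementMark e)) ≡ node (c ∷ r) ∷ [])
  connected⇒Part≡contComplement (hereF {t} {ts} ct z) with connected⇒partForestT-single ct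
  ... | c , r , d , cc = c , r , trans (dropTrivial-Part-∷ t ts) (trans (cong₂ _++_ d (unmarked⇒Part-trivial ts z)) refl) , trans (cong (λ x → dropTrivial (x ∷ Cont (mapF complementMark ts))) cc) (cong (node (c ∷ r) ∷_) (unmarked⇒contComplement-trivial ts z))
  connected⇒Part≡contComplement (thereF {t} {ts} zt cn) with connected⇒Part≡contComplement cn
  ... | c , r , d1 , d2 = c , r , trans (dropTrivial-Part-∷ t ts) (trans (cong (_++ dropTrivial (Part ts)) (unmarked⇒partForestT-trivial t zt)) d1) , trans (cong (λ x → dropTrivial (x ∷ Cont (mapF complementMark ts))) (unmarked⇒contComplementT-trivial t zt)) d2

  partForestT-trivial⇒unmarked : ∀ (t : Tree (A × Bool)) → dropTrivial (partForestT t) ≡ [] → UnmarkedT t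
  partCs-trivial⇒unmarked : ∀ (cs : List ((A × Bool) × Tree (A × Bool))) → proj₁ (partCs cs) ≡ [] → dropTrivial (proj₂ (partCs cs)) ≡ [] → UnmarkedCs cs
  partForestT-trivial⇒unmarked (node cs) e rewrite partForestT-node cs with proj₁ (partCs cs) in eq
  ... | [] = partCs-trivial⇒unmarked cs eq e
  ... | c ∷ r = contradiction e λ ()
  partCs-trivial⇒unmarked [] e1 e2 = []
  partCs-trivial⇒unmarked (((a , true) , t) ∷ cs) e1 e2 rewrite partCs-marked a t cs = contradiction e1 λ ()
  partCs-trivial⇒unmarked (((a , false) , t) ∷ cs) e1 e2 rewrite partCs-unmarked a t cs with ++≡[] (dropTrivial (partForestT t)) (dropTrivial (proj₂ (partCs cs))) (trans (sym (dropTrivial-++ (partForestT t) (proj₂ (partCs cs)))) e2)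
  ... | d1 , d2 = refl ∷ AllP.++⁺ (partForestT-trivial⇒unmarked t d1) (partCs-trivial⇒unmarked cs e1 d2)

  Part-trivial⇒unmarked : ∀ (ts : Forest (A × Bool)) → dropTrivial (Part ts) ≡ [] → UnmarkedF ts
  Part-trivial⇒unmarked [] e = []
  Part-trivial⇒unmarked (t ∷ ts) e with ++≡[] (dropTrivial (partForestT t)) (dropTrivial (Part ts)) (trans (sym (dropTrivial-Part-∷ t ts)) e)
  ... | d1 , d2 = AllP.++⁺ (partForestT-trivial⇒unmarked t d1) (Part-trivial⇒unmarked ts d2)

  partCs-trivial⇒rooted : ∀ (cs : List ((A × Bool) × Tree (A × Bool))) → dropTrivial (proj₂ (partCs cs)) ≡ [] → RootedCs cs
  partCs-trivial⇒rooted [] e = []ʳ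
  partCs-trivial⇒rooted (((a , true) , node ds) ∷ cs) e rewrite partCs-marked a (node ds) cs | partT-node ds with ++≡[] (dropTrivial (proj₂ (partCs ds))) (dropTrivial (proj₂ (partCs cs))) (trans (sym (dropTrivial-++ (proj₂ (partCs ds)) (proj₂ (partCs cs)))) e)
  ... | d1 , d2 = marked∷ refl (partCs-trivial⇒rooted ds d1) (partCs-trivial⇒rooted cs d2)
  partCs-trivial⇒rooted (((a , false) , t) ∷ cs) e rewrite partCs-unmarked a t cs with ++≡[] (dropTrivial (partForestT t)) (dropTrivial (proj₂ (partCs cs))) (trans (sym (dropTrivial-++ (partForestT t) (proj₂ (partCs cs)))) e)
  ... | d1 , d2 = unmarked∷ refl (partForestT-trivial⇒unmarked t d1) (partCs-trivial⇒rooted cs d2)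

  partCs-nonempty⇒marked-label : ∀ (cs : List ((A × Bool) × Tree (A × Bool))) {c r} → proj₁ (partCs cs) ≡ c ∷ r → HasMarkedLabel cs
  partCs-nonempty⇒marked-label [] ()
  partCs-nonempty⇒marked-label (((a , true) , t) ∷ cs) e = here refl
  partCs-nonempty⇒marked-label (((a , false) , t) ∷ cs) e rewrite partCs-unmarked a t cs = there (partCs-nonempty⇒marked-label cs e)

  partForestT-single⇒connected : ∀ (t : Tree (A × Bool)) {T} → dropTrivial (partForestT t) ≡ T ∷ [] → ConnectedT t
  partCs-single⇒connectedBelow : ∀ (cs : List ((A × Bool) × Tree (A × Bool))) {T} → proj₁ (partCs cs) ≡ [] → dropTrivial (proj₂ (partCs cs)) ≡ T ∷ [] → ConnectedBelow cs
  partForestT-single⇒connected (node cs) e rewrite partForestT-node cs with proj₁ (partCs cs) in eq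
  ... | [] = below (partCs-single⇒connectedBelow cs eq e)
  ... | c ∷ r = atRoot (partCs-trivial⇒rooted cs (tl e)) (partCs-nonempty⇒marked-label cs eq)
    where
    tl : ∀ {c r T} {xs : Forest A} → node (c ∷ r) ∷ xs ≡ T ∷ [] → xs ≡ []
    tl refl = refl
  partCs-single⇒connectedBelow [] e1 ()
  partCs-single⇒connectedBelow (((a , true) , t) ∷ cs) e1 e2 rewrite partCs-marked a t cs = contradiction e1 λ ()
  partCs-single⇒connectedBelow (((a , false) , t) ∷ cs) e1 e2 rewrite partCs-unmarked a t cs with ++≡[x] (dropTrivial (partForestT t)) (dropTrivial (proj₂ (partCs cs))) (trans (sym (dropTrivial-++ (partForestT t) (proj₂ (partCs cs)))) e2)
  ... | inj₁ (d1 , d2) = thereB refl (partForestT-trivial⇒unmarked t d1) (partCs-single⇒connectedBelow cs e1 d2)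
  ... | inj₂ (d1 , d2) = hereB refl (partForestT-single⇒connected t d1) (partCs-trivial⇒unmarked cs e1 d2)

  Part-single⇒connected : ∀ (e : Forest (A × Bool)) {T} → dropTrivial (Part e) ≡ T ∷ [] → ConnectedF e
  Part-single⇒connected [] ()
  Part-single⇒connected (t ∷ ts) e with ++≡[x] (dropTrivial (partForestT t)) (dropTrivial (Part ts)) (trans (sym (dropTrivial-Part-∷ t ts)) e)
  ... | inj₁ (d1 , d2) = thereF (partForestT-trivial⇒unmarked t d1) (Part-single⇒connected ts d2)
  ... | inj₂ (d1 , d2) = hereF (partForestT-single⇒connected t d1) (Part-trivial⇒unmarked ts d2)

edgesF-contractT : ∀ {L M : Set} (f : L → Maybe M) (G : Forest L) → edgesF (map (contractT f) G) ≡ mapMaybe f (edgesF G)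
edgesF-contractT f [] = refl
edgesF-contractT f (t ∷ ts) = trans (cong₂ _++_ (edgesT-contractT f t) (edgesF-contractT f ts)) (sym (mapMaybe-++ f (edgesT t) (edgesF ts)))

-- The first block of a generalized partition

PartitionConditions : {D : Set} (k : ℕ) → Forest (D × Fin k) → Set
PartitionConditions k G =
    (∀ (i : Fin k) → i ∈ blocks (edgesF G))
  × (∀ (i : Fin k) (m n : Fin (length G))
       → i ∈ blocks (edgesT (lookup G m))
       → i ∈ blocks (edgesT (lookup G n)) → m ≡ n)
  × (∀ (T : Tree _) → T ∈ G → ∀ (i j : Fin k) (v w : Vtx T)
       → i ∈ blocks (incident v) → i ∈ blocks (incident w)
       → j ∈ blocks (path v w) → ¬ (j ≡ i) → j < i)

module FirstBlock {D : Set} {k : ℕ} where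
  L : Set
  L = D × Fin (suc k)

  dropFirst : L → Maybe (D × Fin k)
  dropFirst (d , zero) = nothing
  dropFirst (d , suc j) = just (d , j)
  isFirst : Fin (suc k) → Bool
  isFirst zero = true
  isFirst (suc _) = false
  inFirst : L → Bool
  inFirst x = isFirst (proj₂ x)
  -- If G encodes (e₁,…,e_{k+1}) on F, restrict G encodes (e₂,…,e_{k+1}) on Cont_{e₁} F.
  restrict : Forest L → Forest (D × Fin k)
  restrict G = map (contractT dropFirst) G
  open MarkedEdges inFirst
  open VertexProjection dropFirst

  first∈blocks⇒marked : ∀ {xs : List L} → zero ∈ blocks xs → Any Marked xs
  first∈blocks⇒marked {(d , zero) ∷ xs} (here refl) = here refl
  first∈blocks⇒marked {x ∷ xs} (there h) = there (first∈blocks⇒marked h)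
  marked⇒first∈blocks : ∀ {xs : List L} → Any Marked xs → zero ∈ blocks xs
  marked⇒first∈blocks {(d , zero) ∷ xs} (here _) = here refl
  marked⇒first∈blocks {(d , suc j) ∷ xs} (here ())
  marked⇒first∈blocks {x ∷ xs} (there h) = there (marked⇒first∈blocks h)
  suc∈blocks⇒∈restrict : ∀ {xs : List L} {i} → suc i ∈ blocks xs → i ∈ blocks (mapMaybe dropFirst xs)
  suc∈blocks⇒∈restrict {(d , zero) ∷ xs} (here ())
  suc∈blocks⇒∈restrict {(d , suc j) ∷ xs} (here refl) = here refl
  suc∈blocks⇒∈restrict {(d , zero) ∷ xs} (there h) = suc∈blocks⇒∈restrict h
  suc∈blocks⇒∈restrict {(d , suc j) ∷ xs} (there h) = there (suc∈blocks⇒∈restrict h)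
  ∈restrict⇒suc∈blocks : ∀ {xs : List L} {i} → i ∈ blocks (mapMaybe dropFirst xs) → suc i ∈ blocks xs
  ∈restrict⇒suc∈blocks {(d , zero) ∷ xs} h = there (∈restrict⇒suc∈blocks h)
  ∈restrict⇒suc∈blocks {(d , suc j) ∷ xs} (here refl) = here refl
  ∈restrict⇒suc∈blocks {(d , suc j) ∷ xs} (there h) = there (∈restrict⇒suc∈blocks h)

  ∈blocks⁻ : ∀ {n} {xs : List (D × Fin n)} {i} → i ∈ blocks xs → Σ (D × Fin n) λ y → y ∈ xs × proj₂ y ≡ i
  ∈blocks⁻ h with ∈-map⁻ proj₂ h
  ... | y , m , e = y , m , sym e
  ∈blocks⁺ : ∀ {n} {xs : List (D × Fin n)} {y} → y ∈ xs → proj₂ y ∈ blocks xs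
  ∈blocks⁺ m = ∈-map⁺ proj₂ m

  dropFirst-just : ∀ {y : L} {x} → dropFirst y ≡ just x → proj₂ y ≡ suc (proj₂ x)
  dropFirst-just {d , zero} ()
  dropFirst-just {d , suc j} refl = refl

  conditions-restrict : ∀ (G : Forest L) → PartitionConditions (suc k) G → ConnectedF G × PartitionConditions k (restrict G)
  conditions-restrict G (nonempty , oneTree , pathCond) = pathClosed⇒connectedF G firstPathClosed firstInOneTree (first∈blocks⇒marked (nonempty zero)) , nonempty′ , oneTree′ , pathCond′
    where
    firstPathClosed : ∀ T → T ∈ G → PathClosed T
    firstPathClosed T TG v w a b = All.tabulate marked-on-path
      where
      marked-on-path : ∀ {y} → y ∈ path v w → inFirst y ≡ true
      marked-on-path {d , zero} m = refl
      marked-on-path {d , suc j} m with pathCond T TG zero (suc j) v w (marked⇒first∈blocks a) (marked⇒first∈blocks b) (∈blocks⁺ m) (λ ())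
      ... | ()
    firstInOneTree : InOneTree G
    firstInOneTree m n a b = oneTree zero m n (marked⇒first∈blocks a) (marked⇒first∈blocks b)
    nonempty′ : ∀ i → i ∈ blocks (edgesF (restrict G))
    nonempty′ i rewrite edgesF-contractT dropFirst G = suc∈blocks⇒∈restrict (nonempty (suc i))
    oneTree′ : ∀ (i : Fin k) (m n : Fin (length (restrict G))) → i ∈ blocks (edgesT (lookup (restrict G) m)) → i ∈ blocks (edgesT (lookup (restrict G) n)) → m ≡ n
    oneTree′ i m n a b rewrite lookup-map (contractT dropFirst) G m | lookup-map (contractT dropFirst) G n | edgesT-contractT dropFirst (lookup G (Fin.cast (length-map (contractT dropFirst) G) m)) | edgesT-contractT dropFirst (lookup G (Fin.cast (length-map (contractT dropFirst) G) n)) =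
      cast-injective (length-map (contractT dropFirst) G) (oneTree (suc i) _ _ (∈restrict⇒suc∈blocks a) (∈restrict⇒suc∈blocks b))
    pathCond′ : ∀ (T' : Tree _) → T' ∈ restrict G → ∀ (i j : Fin k) (v' w' : Vtx T') → i ∈ blocks (incident v') → i ∈ blocks (incident w') → j ∈ blocks (path v' w') → ¬ (j ≡ i) → j < i
    pathCond′ T' TG i j v' w' a b pj ne with ∈-map⁻ (contractT dropFirst) TG
    ... | T , TG0 , refl with ∈blocks⁻ a | ∈blocks⁻ b
    ...   | xa , ma , ea | xb , mb , eb with incident-π⁻¹ v' ma | incident-π⁻¹ w' mb
    ...     | v , refl , ya , mya , fya | w , refl , yb , myb , fyb with pathCond T TG0 (suc i) (suc j) v w
                  (subst (_∈ blocks (incident v)) (trans (dropFirst-just fya) (cong suc ea)) (∈blocks⁺ mya))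
                  (subst (_∈ blocks (incident w)) (trans (dropFirst-just fyb) (cong suc eb)) (∈blocks⁺ myb))
                  (∈restrict⇒suc∈blocks (subst (λ z → j ∈ blocks z) (path-π v w) pj))
                  (λ e → ne (FinP.suc-injective e))
    ...       | s≤s r = r

  conditions-unrestrict : ∀ (G : Forest L) → ConnectedF G → PartitionConditions k (restrict G) → PartitionConditions (suc k) G
  conditions-unrestrict G cn (nonempty′ , oneTree′ , pathCond′) = nonempty , oneTree , pathCond
    where
    nonempty : ∀ i → i ∈ blocks (edgesF G)
    nonempty zero = marked⇒first∈blocks (connectedF⇒any-marked cn)
    nonempty (suc i) = ∈restrict⇒suc∈blocks (subst (λ z → i ∈ blocks z) (edgesF-contractT dropFirst G) (nonempty′ i))
    oneTree : ∀ (i : Fin (suc k)) (m n : Fin (length G)) → i ∈ blocks (edgesT (lookup G m)) → i ∈ blocks (edgesT (lookup G n)) → m ≡ n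
    oneTree zero m n a b = connected⇒inOneTree cn m n (first∈blocks⇒marked a) (first∈blocks⇒marked b)
    oneTree (suc i) m n a b = cast-injective (sym (length-map (contractT dropFirst) G)) e
      where
      suc-block : ∀ m → suc i ∈ blocks (edgesT (lookup G m)) → i ∈ blocks (edgesT (lookup (restrict G) (Fin.cast (sym (length-map (contractT dropFirst) G)) m)))
      suc-block m h rewrite lookup-map (contractT dropFirst) G (Fin.cast (sym (length-map (contractT dropFirst) G)) m) | FinP.cast-involutive (length-map (contractT dropFirst) G) (sym (length-map (contractT dropFirst) G)) m | edgesT-contractT dropFirst (lookup G m) = suc∈blocks⇒∈restrict h
      e : Fin.cast (sym (length-map (contractT dropFirst) G)) m ≡ Fin.cast (sym (length-map (contractT dropFirst) G)) n
      e = oneTree′ i _ _ (suc-block m a) (suc-block n b)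
    pathCond : ∀ (T : Tree _) → T ∈ G → ∀ (i j : Fin (suc k)) (v w : Vtx T) → i ∈ blocks (incident v) → i ∈ blocks (incident w) → j ∈ blocks (path v w) → ¬ (j ≡ i) → j < i
    pathCond T TG zero j v w a b pj ne with ∈blocks⁻ pj
    ... | y , my , ey = ⊥-elim (ne (trans (sym ey) (marked⇒first {y} (All.lookup {P = Marked} (connectedF⇒pathClosed cn T TG v w (first∈blocks⇒marked a) (first∈blocks⇒marked b)) my))))
      where
      marked⇒first : ∀ {y : L} → inFirst y ≡ true → proj₂ y ≡ zero
      marked⇒first {d , zero} _ = refl
      marked⇒first {d , suc _} ()
    pathCond T TG (suc i) zero v w a b pj ne = s≤s z≤n
    pathCond T TG (suc i) (suc j) v w a b pj ne = s≤s (pathCond′ (contractT dropFirst T) (∈-map⁺ (contractT dropFirst) TG) i j (πT v) (πT w) (suc-block v a) (suc-block w b)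
                                             (subst (λ z → j ∈ blocks z) (sym (path-π v w)) (suc∈blocks⇒∈restrict pj)) (λ e → ne (cong suc e)))
      where
      suc-block : ∀ (u : Vtx T) → suc i ∈ blocks (incident u) → i ∈ blocks (incident (πT u))
      suc-block u h with ∈blocks⁻ h
      ... | (d , .(suc i)) , m , refl = ∈blocks⁺ (incident-π u m refl)

marks-length : ∀ {A B : Set} (t t' : Tree (A × B)) → mapT proj₁ t ≡ mapT proj₁ t' → length (map proj₂ (edgesT t)) ≡ length (map proj₂ (edgesT t'))
marks-length t t' e = trans (length-map proj₂ (edgesT t)) (trans (sym (length-map proj₁ (edgesT t))) (trans (cong length (trans (sym (edgesT-mapT proj₁ t)) (trans (cong edgesT e) (edgesT-mapT proj₁ t')))) (trans (length-map proj₁ (edgesT t')) (sym (length-map proj₂ (edgesT t'))))))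

marks-injectiveT : ∀ {A B : Set} (t t' : Tree (A × B)) → mapT proj₁ t ≡ mapT proj₁ t' → map proj₂ (edgesT t) ≡ map proj₂ (edgesT t') → t ≡ t'
marks-injectiveCs : ∀ {A B : Set} (cs cs' : List ((A × B) × Tree (A × B))) → mapCs proj₁ cs ≡ mapCs proj₁ cs' → map proj₂ (edgesCs cs) ≡ map proj₂ (edgesCs cs') → cs ≡ cs'
marks-injectiveT (node cs) (node cs') e1 e2 = cong node (marks-injectiveCs cs cs' (cong children e1) e2)
marks-injectiveCs [] [] e1 e2 = refl
marks-injectiveCs [] (x ∷ cs') () e2
marks-injectiveCs (x ∷ cs) [] () e2
marks-injectiveCs ((l , t) ∷ cs) ((l' , t') ∷ cs') e1 e2 with ∷-injective e1 | ∷-injective e2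
... | h1 , r1 | b-eq , rest with ,-injective h1
...   | a-eq , tsh with ++-cancel-≡-length (map proj₂ (edgesT t)) (map proj₂ (edgesT t')) (marks-length t t' tsh)
                        (trans (sym (map-++ proj₂ (edgesT t) (edgesCs cs))) (trans rest (map-++ proj₂ (edgesT t') (edgesCs cs'))))
...     | et , ecs = cong₂ _∷_ (cong₂ _,_ (cong₂ _,_ a-eq b-eq) (marks-injectiveT t t' tsh et)) (marks-injectiveCs cs cs' r1 ecs)

marks-injectiveF : ∀ {A B : Set} (X Y : Forest (A × B)) → mapF proj₁ X ≡ mapF proj₁ Y → map proj₂ (edgesF X) ≡ map proj₂ (edgesF Y) → X ≡ Y
marks-injectiveF [] [] e1 e2 = refl
marks-injectiveF [] (x ∷ Y) () e2
marks-injectiveF (x ∷ X) [] () e2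
marks-injectiveF (t ∷ X) (t' ∷ Y) e1 e2 with ∷-injective e1
... | h , r with ++-cancel-≡-length (map proj₂ (edgesT t)) (map proj₂ (edgesT t')) (marks-length t t' h)
                 (trans (sym (map-++ proj₂ (edgesT t) (edgesF X))) (trans e2 (map-++ proj₂ (edgesT t') (edgesF Y))))
...   | et , eX = cong₂ _∷_ (marks-injectiveT t t' h et) (marks-injectiveF X Y r eX)

module Extension {D : Set} {k : ℕ} where
  open FirstBlock {D} {k}

  firstMark : L → D × Bool
  firstMark (d , i) = (d , isFirst i)
  markFirst : Forest L → Forest (D × Bool)
  markFirst = mapF firstMark

  -- Inverse of restrict: the marked edges of e form block zero and the unmarked ones take,
  -- in order, the blocks (shifted up) of the labelling G′ of Cont e; extendCs also returns
  -- the unconsumed children of G′.  On a shape mismatch the result is junk.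
  extendT : Tree (D × Bool) → Tree (D × Fin k) → Tree L
  extendCs : List ((D × Bool) × Tree (D × Bool)) → List ((D × Fin k) × Tree (D × Fin k)) → List (L × Tree L) × List ((D × Fin k) × Tree (D × Fin k))
  extendT (node cs) (node cs') = node (proj₁ (extendCs cs cs'))
  extendCs [] r = [] , r
  extendCs (((d , true) , node ds) ∷ cs) r = ((d , zero) , node (proj₁ (extendCs ds r))) ∷ proj₁ (extendCs cs (proj₂ (extendCs ds r))) , proj₂ (extendCs cs (proj₂ (extendCs ds r)))
  extendCs (((d , false) , t) ∷ cs) [] = ((d , zero) , extendT t (node [])) ∷ proj₁ (extendCs cs []) , proj₂ (extendCs cs [])
  extendCs (((d , false) , t) ∷ cs) (((d' , j) , t') ∷ r) = ((d , suc j) , extendT t t') ∷ proj₁ (extendCs cs r) , proj₂ (extendCs cs r)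

  extend : Forest (D × Bool) → Forest (D × Fin k) → Forest L
  extend [] _ = []
  extend (t ∷ ts) [] = extendT t (node []) ∷ extend ts []
  extend (t ∷ ts) (t' ∷ ts') = extendT t t' ∷ extend ts ts'

  extendCs-restrict : ∀ (cs : List (L × Tree L)) r → extendCs (mapCs firstMark cs) (contractCs dropFirst cs ++ r) ≡ (cs , r)
  extendT-restrict : ∀ (t : Tree L) → extendT (mapT firstMark t) (contractT dropFirst t) ≡ t
  extendCs-restrict [] r = refl
  extendCs-restrict (((d , zero) , node ds) ∷ cs) r rewrite ++-assoc (contractCs dropFirst ds) (contractCs dropFirst cs) r | extendCs-restrict ds (contractCs dropFirst cs ++ r) | extendCs-restrict cs r = refl
  extendCs-restrict (((d , suc j) , t) ∷ cs) r rewrite extendCs-restrict cs r | extendT-restrict t = refl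
  extendT-restrict (node ds) = trans (cong (λ z → node (proj₁ (extendCs (mapCs firstMark ds) z))) (sym (++-identityʳ (contractCs dropFirst ds)))) (cong (λ z → node (proj₁ z)) (extendCs-restrict ds []))

  extend-restrict : ∀ (G : Forest L) → extend (markFirst G) (restrict G) ≡ G
  extend-restrict [] = refl
  extend-restrict (t ∷ ts) = cong₂ _∷_ (extendT-restrict t) (extend-restrict ts)

  mapCs-++⁻ : ∀ {X Y : Set} (g : X → Y) (ys : List (X × Tree X)) (as bs : List (Y × Tree Y)) → mapCs g ys ≡ as ++ bs →
             Σ _ λ ys1 → Σ _ λ ys2 → ys ≡ ys1 ++ ys2 × mapCs g ys1 ≡ as × mapCs g ys2 ≡ bs
  mapCs-++⁻ g ys [] bs e = [] , ys , refl , refl , e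
  mapCs-++⁻ g [] (a ∷ as) bs ()
  mapCs-++⁻ g (y ∷ ys) (a ∷ as) bs e with ∷-injective e
  ... | e1 , e2 with mapCs-++⁻ g ys as bs e2
  ...   | ys1 , ys2 , refl , m1 , m2 = y ∷ ys1 , ys2 , refl , cong₂ _∷_ e1 m1 , m2

  restrictCs-extendCs : ∀ (cs : List ((D × Bool) × Tree (D × Bool))) ys r → mapCs proj₁ ys ≡ contractCs keepUnmarked cs →
        Σ _ λ X → extendCs cs (ys ++ r) ≡ (X , r) × mapCs firstMark X ≡ cs × contractCs dropFirst X ≡ ys
  restrictCs-extendCs [] [] r e = [] , refl , refl , refl
  restrictCs-extendCs [] (y ∷ ys) r ()
  restrictCs-extendCs (((d , true) , node ds) ∷ cs) ys r e with mapCs-++⁻ proj₁ ys (contractCs keepUnmarked ds) (contractCs keepUnmarked cs) e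
  ... | ys1 , ys2 , refl , m1 , m2 rewrite ++-assoc ys1 ys2 r with restrictCs-extendCs ds ys1 (ys2 ++ r) m1
  ...   | Xd , eqd , md , cd rewrite eqd with restrictCs-extendCs cs ys2 r m2
  ...     | Xc , eqc , outside , cc rewrite eqc = ((d , zero) , node Xd) ∷ Xc , refl , cong₂ (λ a b → ((d , true) , node a) ∷ b) md outside , cong₂ _++_ cd cc
  restrictCs-extendCs (((d , false) , node ds) ∷ cs) [] r ()
  restrictCs-extendCs (((d , false) , node ds) ∷ cs) (((d' , j) , node ds') ∷ ys) r e with ∷-injective e
  ... | h , et with ,-injective h
  ...   | refl , en with restrictCs-extendCs ds ds' [] (cong children en) | restrictCs-extendCs cs ys r et
  ...     | Xd , eqd , md , cd | Xc , eqc , outside , cc rewrite ++-identityʳ ds' | eqd | eqc =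
            ((d , suc j) , node Xd) ∷ Xc , refl , cong₂ (λ a b → ((d , false) , node a) ∷ b) md outside , cong₂ (λ a b → ((d , j) , node a) ∷ b) cd cc

  restrict-extend : ∀ (e : Forest (D × Bool)) (G' : Forest (D × Fin k)) → mapF proj₁ G' ≡ Cont e → markFirst (extend e G') ≡ e × restrict (extend e G') ≡ G'
  restrict-extend [] [] h = refl , refl
  restrict-extend [] (x ∷ G') ()
  restrict-extend (t ∷ e) [] ()
  restrict-extend (node cs ∷ e) (node cs' ∷ G') h with ∷-injective h
  ... | h1 , h2 with restrictCs-extendCs cs cs' [] (trans (cong children h1) (contCs-contractCs cs)) | restrict-extend e G' h2
  ...   | X , eqX , mX , cX | r1 , r2 rewrite ++-identityʳ cs' | eqX = cong₂ _∷_ (cong node mX) r1 , cong₂ _∷_ (cong node cX) r2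

  shape-markFirst : ∀ (G : Forest L) → mapF proj₁ (markFirst G) ≡ mapF proj₁ G
  shape-markFirst [] = refl
  shape-markFirst (t ∷ G) = cong₂ _∷_ (trans (mapT-∘ firstMark proj₁ t) (mapT-cong _ _ (λ x → refl) t)) (shape-markFirst G)

  shape-restrict : ∀ (G : Forest L) → mapF proj₁ (restrict G) ≡ Cont (markFirst G)
  shape-restrict [] = refl
  shape-restrict (t ∷ G) = cong₂ _∷_ (trans (mapT-contractT dropFirst proj₁ t) (trans (contractT-cong _ _ pw t) (trans (sym (contractT-mapT firstMark keepUnmarked t)) (sym (contT-contractT (mapT firstMark t)))))) (shape-restrict G)
    where
    pw : ∀ (x : L) → Maybe.map proj₁ (dropFirst x) ≡ keepUnmarked (firstMark x)
    pw (d , zero) = refl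
    pw (d , suc j) = refl

  outside : ∀ {n} → Fin n → D × Fin n → D × Bool
  outside j (d , i) = (d , not (does (i ≟ j)))

  Cont-markCompl-suc : ∀ (j : Fin k) (G : Forest L) → Cont (markCompl (suc j) G) ≡ Cont (markCompl j (restrict G))
  Cont-markCompl-suc j [] = refl
  Cont-markCompl-suc j (t ∷ G) = cong₂ _∷_ eqT (Cont-markCompl-suc j G)
    where
    pw : ∀ (x : L) → keepUnmarked (outside (suc j) x) ≡ (dropFirst x >>= λ y → keepUnmarked (outside j y))
    pw (d , zero) = refl
    pw (d , suc i) = refl
    eqT : contT (mapT (λ { (d , i) → (d , not (does (i ≟ suc j))) }) t) ≡ contT (mapT (λ { (d , i) → (d , not (does (i ≟ j))) }) (contractT dropFirst t))
    eqT = trans (contT-contractT _) (trans (cong (contractT keepUnmarked) (mapT-cong _ (outside (suc j)) (λ x → refl) t)) (trans (contractT-mapT (outside (suc j)) keepUnmarked t)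
            (trans (contractT-cong _ _ pw t) (trans (sym (contractT-∘ dropFirst (λ y → keepUnmarked (outside j y)) t)) (trans (sym (contractT-mapT (outside j) keepUnmarked (contractT dropFirst t)))
            (trans (cong (contractT keepUnmarked) (mapT-cong (outside j) _ (λ x → refl) (contractT dropFirst t))) (sym (contT-contractT _))))))))

  Cont-markCompl-zero : ∀ (G : Forest L) → Cont (markCompl zero G) ≡ Cont (mapF complementMark (markFirst G))
  Cont-markCompl-zero [] = refl
  Cont-markCompl-zero (t ∷ G) = cong₂ _∷_ (cong contT (trans (mapT-cong _ _ pw t) (sym (mapT-∘ firstMark complementMark t)))) (Cont-markCompl-zero G)
    where
    pw : ∀ (x : L) → (proj₁ x , not (does (proj₂ x ≟ zero))) ≡ complementMark (firstMark x)
    pw (d , zero) = refl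
    pw (d , suc i) = refl

-- Counting edge subsets

module Counting where
  open import Data.Nat using (_+_; _*_)
  open import Data.Nat.Properties using (+-identityʳ; *-distribʳ-+; *-distribˡ-+; *-zeroʳ)
  open import Data.Nat.ListAction using (sum)
  open import Data.Nat.ListAction.Properties using (sum-++)

  indicator : Bool → ℕ
  indicator true = 1
  indicator false = 0

  count : ∀ {X : Set} → (X → Bool) → List X → ℕ
  count p xs = sum (map (λ x → indicator (p x)) xs)

  sum-concatMap : ∀ {X Y : Set} (f : Y → ℕ) (g : X → List Y) (xs : List X) → sum (map f (concatMap g xs)) ≡ sum (map (λ x → sum (map f (g x))) xs)
  sum-concatMap f g [] = refl
  sum-concatMap f g (x ∷ xs) = trans (cong sum (map-++ f (g x) (concatMap g xs))) (trans (sum-++ (map f (g x)) (map f (concatMap g xs))) (cong (sum (map f (g x)) +_) (sum-concatMap f g xs)))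

  sum-cong : ∀ {X : Set} (f g : X → ℕ) (xs : List X) → (∀ {x} → x ∈ xs → f x ≡ g x) → sum (map f xs) ≡ sum (map g xs)
  sum-cong f g [] h = refl
  sum-cong f g (x ∷ xs) h = cong₂ _+_ (h (here refl)) (sum-cong f g xs (λ m → h (there m)))

  sum-*ʳ : ∀ {X : Set} (f : X → ℕ) (c : ℕ) (xs : List X) → sum (map (λ x → f x * c) xs) ≡ sum (map f xs) * c
  sum-*ʳ f c [] = refl
  sum-*ʳ f c (x ∷ xs) = trans (cong (f x * c +_) (sum-*ʳ f c xs)) (sym (*-distribʳ-+ c (f x) (sum (map f xs))))

  sum-*ˡ : ∀ {X : Set} (f : X → ℕ) (c : ℕ) (xs : List X) → sum (map (λ x → c * f x) xs) ≡ c * sum (map f xs)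
  sum-*ˡ f c [] = sym (*-zeroʳ c)
  sum-*ˡ f c (x ∷ xs) = trans (cong (c * f x +_) (sum-*ˡ f c xs)) (sym (*-distribˡ-+ c (f x) (sum (map f xs))))

  _≡ᵇ_ : Bool → Bool → Bool
  true ≡ᵇ true = true
  false ≡ᵇ false = true
  true ≡ᵇ false = false
  false ≡ᵇ true = false

  eqBits : List Bool → List Bool → Bool
  eqBits [] [] = true
  eqBits [] (_ ∷ _) = false
  eqBits (_ ∷ _) [] = false
  eqBits (x ∷ xs) (y ∷ ys) = (x ≡ᵇ y) ∧ eqBits xs ys

  eqBits-sound : ∀ xs ys → T (eqBits xs ys) → xs ≡ ys
  eqBits-sound [] [] e = refl
  eqBits-sound [] (_ ∷ _) ()
  eqBits-sound (_ ∷ _) [] ()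
  eqBits-sound (true ∷ xs) (true ∷ ys) e = cong (true ∷_) (eqBits-sound xs ys e)
  eqBits-sound (false ∷ xs) (false ∷ ys) e = cong (false ∷_) (eqBits-sound xs ys e)
  eqBits-sound (true ∷ xs) (false ∷ ys) ()
  eqBits-sound (false ∷ xs) (true ∷ ys) ()

  eqBits-refl : ∀ xs → T (eqBits xs xs)
  eqBits-refl [] = _
  eqBits-refl (true ∷ xs) = eqBits-refl xs
  eqBits-refl (false ∷ xs) = eqBits-refl xs

  eqBits-++ : ∀ a c {b d} → length a ≡ length c → eqBits (a ++ b) (c ++ d) ≡ eqBits a c ∧ eqBits b d
  eqBits-++ [] [] l = refl
  eqBits-++ (x ∷ a) (y ∷ c) {b} {d} l = trans (cong ((x ≡ᵇ y) ∧_) (eqBits-++ a c {b} {d} (NatP.suc-injective l))) (sym (BoolP.∧-assoc (x ≡ᵇ y) (eqBits a c) (eqBits b d)))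

  indicator-∧ : ∀ a b → indicator (a ∧ b) ≡ indicator a * indicator b
  indicator-∧ true b = sym (+-identityʳ (indicator b))
  indicator-∧ false b = refl

  indicator-split : ∀ (β q : Bool) → indicator ((true ≡ᵇ β) ∧ q) + (indicator ((false ≡ᵇ β) ∧ q) + 0) ≡ indicator q
  indicator-split true true = refl
  indicator-split true false = refl
  indicator-split false true = refl
  indicator-split false false = refl

  module MarkCount {D : Set} where
    bitsT : Tree (D × Bool) → List Bool
    bitsT t = map proj₂ (edgesT t)
    bitsCs : List ((D × Bool) × Tree (D × Bool)) → List Bool
    bitsCs cs = map proj₂ (edgesCs cs)
    bitsF : Forest (D × Bool) → List Bool
    bitsF F = map proj₂ (edgesF F)

    shape-marksT : ∀ (t : Tree D) → All (λ t' → mapT proj₁ t' ≡ t) (marksT t)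
    shape-marksCs : ∀ (cs : List (D × Tree D)) → All (λ c' → mapCs proj₁ c' ≡ cs) (marksCs cs)
    shape-marksT (node cs) = AllP.map⁺ (All.tabulate (λ m → cong node (All.lookup (shape-marksCs cs) m)))
    shape-marksCs [] = refl ∷ []
    shape-marksCs ((l , t) ∷ cs) = AllP.concat⁺ (AllP.map⁺ (All.tabulate λ m1 → AllP.concat⁺ (AllP.map⁺ (All.tabulate λ m2 →
       let e = cong₂ (λ a b → (l , a) ∷ b) (All.lookup (shape-marksT t) m1) (All.lookup (shape-marksCs cs) m2) in e ∷ e ∷ []))))

    shape-subsetsF : ∀ (F : Forest D) → All (λ e → mapF proj₁ e ≡ F) (subsetsF F)
    shape-subsetsF [] = refl ∷ []
    shape-subsetsF (t ∷ ts) = AllP.concat⁺ (AllP.map⁺ (All.tabulate λ m1 → AllP.map⁺ (All.tabulate λ m2 → cong₂ _∷_ (All.lookup (shape-marksT t) m1) (All.lookup (shape-subsetsF ts) m2))))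

    count-marksT : ∀ (t : Tree D) (x : Tree (D × Bool)) → mapT proj₁ x ≡ t → count (λ y → eqBits (bitsT y) (bitsT x)) (marksT t) ≡ 1
    count-marksCs : ∀ (cs : List (D × Tree D)) (x : List ((D × Bool) × Tree (D × Bool))) → mapCs proj₁ x ≡ cs → count (λ y → eqBits (bitsCs y) (bitsCs x)) (marksCs cs) ≡ 1
    count-marksT (node cs) (node xs) refl = trans (cong sum (sym (Data.List.Properties.map-∘ (marksCs cs)))) (count-marksCs cs xs refl)
    count-marksCs [] [] refl = refl
    count-marksCs ((l , t) ∷ cs) (((.l , β) , tx) ∷ xs) refl =
      trans (sum-concatMap (λ y → indicator (sameMarks y)) (λ t' → concatMap (λ cs' → (((l , true) , t') ∷ cs') ∷ (((l , false) , t') ∷ cs') ∷ []) (marksCs (mapCs proj₁ xs))) (marksT (mapT proj₁ tx)))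
      (trans (sum-cong _ (λ t' → indicator (eqBits (bitsT t') (bitsT tx)) * count (λ y → eqBits (bitsCs y) (bitsCs xs)) (marksCs (mapCs proj₁ xs))) (marksT (mapT proj₁ tx)) count-child)
      (trans (sum-*ʳ (λ t' → indicator (eqBits (bitsT t') (bitsT tx))) (count (λ y → eqBits (bitsCs y) (bitsCs xs)) (marksCs (mapCs proj₁ xs))) (marksT (mapT proj₁ tx))) (cong₂ _*_ (count-marksT (mapT proj₁ tx) tx refl) (count-marksCs (mapCs proj₁ xs) xs refl))))
      where
      sameMarks : List ((D × Bool) × Tree (D × Bool)) → Bool
      sameMarks y = eqBits (bitsCs y) (bitsCs (((l , β) , tx) ∷ xs))
      count-child : ∀ {t'} → t' ∈ marksT (mapT proj₁ tx) →
        sum (map (λ y → indicator (sameMarks y)) (concatMap (λ cs' → (((l , true) , t') ∷ cs') ∷ (((l , false) , t') ∷ cs') ∷ []) (marksCs (mapCs proj₁ xs))))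
          ≡ indicator (eqBits (bitsT t') (bitsT tx)) * count (λ y → eqBits (bitsCs y) (bitsCs xs)) (marksCs (mapCs proj₁ xs))
      count-child {t'} m1 = trans (sum-concatMap (λ y → indicator (sameMarks y)) (λ cs' → (((l , true) , t') ∷ cs') ∷ (((l , false) , t') ∷ cs') ∷ []) (marksCs (mapCs proj₁ xs)))
                  (trans (sum-cong _ (λ c' → indicator (eqBits (bitsT t') (bitsT tx)) * indicator (eqBits (bitsCs c') (bitsCs xs))) (marksCs (mapCs proj₁ xs)) count-rest)
                   (sum-*ˡ (λ c' → indicator (eqBits (bitsCs c') (bitsCs xs))) (indicator (eqBits (bitsT t') (bitsT tx))) (marksCs (mapCs proj₁ xs))))
        where
        count-rest : ∀ {c'} → c' ∈ marksCs (mapCs proj₁ xs) →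
          sum (map (λ y → indicator (sameMarks y)) ((((l , true) , t') ∷ c') ∷ (((l , false) , t') ∷ c') ∷ [])) ≡ indicator (eqBits (bitsT t') (bitsT tx)) * indicator (eqBits (bitsCs c') (bitsCs xs))
        count-rest {c'} m2 = trans (indicator-split β (eqBits (map proj₂ (edgesT t' ++ edgesCs c')) (map proj₂ (edgesT tx ++ edgesCs xs))))
                         (trans (cong indicator (trans (cong₂ eqBits (map-++ proj₂ (edgesT t') (edgesCs c')) (map-++ proj₂ (edgesT tx) (edgesCs xs)))
                          (eqBits-++ (bitsT t') (bitsT tx) (marks-length t' tx (All.lookup (shape-marksT (mapT proj₁ tx)) m1))))) (indicator-∧ (eqBits (bitsT t') (bitsT tx)) (eqBits (bitsCs c') (bitsCs xs))))

    count-subsetsF : ∀ (F : Forest D) (x : Forest (D × Bool)) → mapF proj₁ x ≡ F → count (λ y → eqBits (bitsF y) (bitsF x)) (subsetsF F) ≡ 1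
    count-subsetsF [] [] refl = refl
    count-subsetsF (t ∷ ts) (tx ∷ xs) refl =
      trans (sum-concatMap (λ y → indicator (sameMarks y)) (λ t' → map (t' ∷_) (subsetsF (mapF proj₁ xs))) (marksT (mapT proj₁ tx)))
      (trans (sum-cong _ (λ t' → indicator (eqBits (bitsT t') (bitsT tx)) * count (λ y → eqBits (bitsF y) (bitsF xs)) (subsetsF (mapF proj₁ xs))) (marksT (mapT proj₁ tx)) count-child)
      (trans (sum-*ʳ (λ t' → indicator (eqBits (bitsT t') (bitsT tx))) (count (λ y → eqBits (bitsF y) (bitsF xs)) (subsetsF (mapF proj₁ xs))) (marksT (mapT proj₁ tx)))
        (cong₂ _*_ (count-marksT (mapT proj₁ tx) tx refl) (count-subsetsF (mapF proj₁ xs) xs refl))))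
      where
      sameMarks : Forest (D × Bool) → Bool
      sameMarks y = eqBits (bitsF y) (bitsF (tx ∷ xs))
      count-child : ∀ {t'} → t' ∈ marksT (mapT proj₁ tx) →
        sum (map (λ y → indicator (sameMarks y)) (map (t' ∷_) (subsetsF (mapF proj₁ xs))))
          ≡ indicator (eqBits (bitsT t') (bitsT tx)) * count (λ y → eqBits (bitsF y) (bitsF xs)) (subsetsF (mapF proj₁ xs))
      count-child {t'} m1 = trans (cong sum (sym (Data.List.Properties.map-∘ (subsetsF (mapF proj₁ xs)))))
        (trans (sum-cong _ (λ y → indicator (eqBits (bitsT t') (bitsT tx)) * indicator (eqBits (bitsF y) (bitsF xs))) (subsetsF (mapF proj₁ xs)) count-rest)
          (sum-*ˡ (λ y → indicator (eqBits (bitsF y) (bitsF xs))) (indicator (eqBits (bitsT t') (bitsT tx))) (subsetsF (mapF proj₁ xs))))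
        where
        count-rest : ∀ {y} → y ∈ subsetsF (mapF proj₁ xs) → indicator (sameMarks (t' ∷ y)) ≡ indicator (eqBits (bitsT t') (bitsT tx)) * indicator (eqBits (bitsF y) (bitsF xs))
        count-rest {y} m2 = trans (cong indicator (trans (cong₂ eqBits (map-++ proj₂ (edgesT t') (edgesF y)) (map-++ proj₂ (edgesT tx) (edgesF xs)))
                          (eqBits-++ (bitsT t') (bitsT tx) (marks-length t' tx (All.lookup (shape-marksT (mapT proj₁ tx)) m1))))) (indicator-∧ (eqBits (bitsT t') (bitsT tx)) (eqBits (bitsF y) (bitsF xs)))

open Counting

-- The expansion of Φ

module Sums {c ℓ} (K : CommutativeRing c ℓ) where
  open CommutativeRing K renaming (Carrier to 𝕂; refl to ≈refl; sym to ≈sym; trans to ≈trans) hiding (zero)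
  open import Relation.Binary.Reasoning.Setoid setoid

  ∑ : ∀ {X : Set} → (X → 𝕂) → List X → 𝕂
  ∑ f xs = foldr _+_ 0# (map f xs)

  ∑-cong : ∀ {X : Set} (f g : X → 𝕂) (xs : List X) → (∀ {x} → x ∈ xs → f x ≈ g x) → ∑ f xs ≈ ∑ g xs
  ∑-cong f g [] h = ≈refl
  ∑-cong f g (x ∷ xs) h = +-cong (h (here refl)) (∑-cong f g xs (λ m → h (there m)))

  ∑-zero : ∀ {X : Set} (f : X → 𝕂) (xs : List X) → (∀ {x} → x ∈ xs → f x ≈ 0#) → ∑ f xs ≈ 0#
  ∑-zero f [] h = ≈refl
  ∑-zero f (x ∷ xs) h = ≈trans (+-cong (h (here refl)) (∑-zero f xs (λ m → h (there m)))) (+-identityˡ 0#)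

  ∑-*ˡ : ∀ {X : Set} (a : 𝕂) (f : X → 𝕂) (xs : List X) → a * ∑ f xs ≈ ∑ (λ x → a * f x) xs
  ∑-*ˡ a f [] = zeroʳ a
  ∑-*ˡ a f (x ∷ xs) = ≈trans (distribˡ a (f x) (∑ f xs)) (+-cong ≈refl (∑-*ˡ a f xs))

  ∑-+ : ∀ {X : Set} (f g : X → 𝕂) (xs : List X) → ∑ (λ x → f x + g x) xs ≈ ∑ f xs + ∑ g xs
  ∑-+ f g [] = ≈sym (+-identityˡ 0#)
  ∑-+ f g (x ∷ xs) = begin
      (f x + g x) + ∑ (λ x → f x + g x) xs ≈⟨ +-cong ≈refl (∑-+ f g xs) ⟩
      (f x + g x) + (∑ f xs + ∑ g xs) ≈⟨ +-assoc (f x) (g x) _ ⟩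
      f x + (g x + (∑ f xs + ∑ g xs)) ≈⟨ +-cong ≈refl (≈sym (+-assoc (g x) (∑ f xs) (∑ g xs))) ⟩
      f x + ((g x + ∑ f xs) + ∑ g xs) ≈⟨ +-cong ≈refl (+-cong (+-comm (g x) (∑ f xs)) ≈refl) ⟩
      f x + ((∑ f xs + g x) + ∑ g xs) ≈⟨ +-cong ≈refl (+-assoc (∑ f xs) (g x) (∑ g xs)) ⟩
      f x + (∑ f xs + (g x + ∑ g xs)) ≈⟨ ≈sym (+-assoc (f x) (∑ f xs) _) ⟩
      (f x + ∑ f xs) + (g x + ∑ g xs) ∎

  ∑-swap : ∀ {X Y : Set} (h : X → Y → 𝕂) (xs : List X) (ys : List Y) → ∑ (λ x → ∑ (h x) ys) xs ≈ ∑ (λ y → ∑ (λ x → h x y) xs) ys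
  ∑-swap h [] ys = ≈sym (∑-zero (λ y → 0#) ys (λ _ → ≈refl))
  ∑-swap h (x ∷ xs) ys = ≈trans (+-cong ≈refl (∑-swap h xs ys)) (≈sym (∑-+ (h x) (λ y → ∑ (λ x → h x y) xs) ys))

  ∑-map : ∀ {X Y : Set} (f : Y → 𝕂) (g : X → Y) (xs : List X) → ∑ f (map g xs) ≡ ∑ (f ∘ g) xs
  ∑-map f g [] = refl
  ∑-map f g (x ∷ xs) = cong (f (g x) +_) (∑-map f g xs)

  ∑-filterᵇ : ∀ {X : Set} (f : X → 𝕂) (q : X → Bool) (xs : List X) → ∑ f (filterᵇ q xs) ≈ ∑ (λ x → if q x then f x else 0#) xs
  ∑-filterᵇ f q [] = ≈refl
  ∑-filterᵇ f q (x ∷ xs) with q x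
  ... | true = +-cong ≈refl (∑-filterᵇ f q xs)
  ... | false = ≈trans (∑-filterᵇ f q xs) (≈sym (+-identityˡ _))

  ∑-if-count₀ : ∀ {X : Set} (a : 𝕂) (q : X → Bool) (xs : List X) → count q xs ≡ 0 → ∑ (λ x → if q x then a else 0#) xs ≈ 0#
  ∑-if-count₀ a q [] e = ≈refl
  ∑-if-count₀ a q (x ∷ xs) e with q x
  ... | true = ⊥-elim (NatP.1+n≢0 e)
  ... | false = ≈trans (+-cong ≈refl (∑-if-count₀ a q xs e)) (+-identityˡ 0#)

  ∑-if-count₁ : ∀ {X : Set} (a : 𝕂) (q : X → Bool) (xs : List X) → count q xs ≡ 1 → ∑ (λ x → if q x then a else 0#) xs ≈ a
  ∑-if-count₁ a q [] ()
  ∑-if-count₁ a q (x ∷ xs) e with q x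
  ... | true = ≈trans (+-cong ≈refl (∑-if-count₀ a q xs (NatP.suc-injective e))) (+-identityʳ a)
  ... | false = ≈trans (+-identityˡ _) (∑-if-count₁ a q xs e)

  ∑-regroup : ∀ {X Y : Set} (g : Y → 𝕂) (q : X → Y → Bool) (xs : List X) (ys : List Y) →
              (∀ {y} → y ∈ ys → count (λ x → q x y) xs ≡ 1) → ∑ (λ x → ∑ g (filterᵇ (q x) ys)) xs ≈ ∑ g ys
  ∑-regroup g q xs ys once = begin
    ∑ (λ x → ∑ g (filterᵇ (q x) ys)) xs                    ≈⟨ ∑-cong _ _ xs (λ {x} _ → ∑-filterᵇ g (q x) ys) ⟩
    ∑ (λ x → ∑ (λ y → if q x y then g y else 0#) ys) xs    ≈⟨ ∑-swap (λ x y → if q x y then g y else 0#) xs ys ⟩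
    ∑ (λ y → ∑ (λ x → if q x y then g y else 0#) xs) ys    ≈⟨ ∑-cong _ _ ys (λ {y} m → ∑-if-count₁ (g y) (λ x → q x y) xs (once m)) ⟩
    ∑ g ys                                                 ∎

module Expansion {c ℓ} (K : CommutativeRing c ℓ) (D : Set) where
  open CommutativeRing K renaming (Carrier to 𝕂; refl to ≈refl; sym to ≈sym; trans to ≈trans) hiding (zero)
  open import Relation.Binary.Reasoning.Setoid setoid
  open Alg K D
  open Sums K
  open MarkCount {D}
  open FirstBlock {D} using (restrict; inFirst; conditions-restrict; conditions-unrestrict)
  open Extension {D} using (firstMark; markFirst; extend; extend-restrict; restrict-extend; shape-markFirst; shape-restrict; Cont-markCompl-zero; Cont-markCompl-suc)

  Labelling : Set
  Labelling = Σ ℕ λ k → Forest (D × Fin k)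

  -- IsGenPartition without 1 ≤ k: an edgeless forest then has exactly one generalized partition, the empty tuple.
  IsGenPartition₀ : Forest D → (k : ℕ) → Forest (D × Fin k) → Set
  IsGenPartition₀ F k G = (mapF proj₁ G ≡ F) × (k ≤ nEdges F) × PartitionConditions k G

  Enumerates : Forest D → List Labelling → Set
  Enumerates F Ps = ∀ k G → ((k , G) ∈ Ps → IsGenPartition₀ F k G) × (IsGenPartition₀ F k G → (k , G) ∈ Ps)

  restrictLabelling : Labelling → Labelling
  restrictLabelling (zero , G) = zero , G
  restrictLabelling (suc k , G) = k , restrict G

  firstBlockIs : Forest (D × Bool) → Labelling → Bool
  firstBlockIs e (zero , G) = false
  firstBlockIs e (suc k , G) = eqBits (bitsF e) (bitsF (markFirst G))

  ,-injectiveʳ-Labelling : ∀ {k} {G H : Forest (D × Fin k)} → _≡_ {A = Labelling} (k , G) (k , H) → G ≡ H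
  ,-injectiveʳ-Labelling refl = refl

  length-edgesF : ∀ {X Y : Set} (G : Forest (X × Y)) → length (edgesF G) ≡ nEdges (mapF proj₁ G)
  length-edgesF G = sym (trans (cong length (edgesF-mapF proj₁ G)) (length-map proj₁ (edgesF G)))

  nEdges-zero-or-positive : ∀ (F : Forest D) → (nEdges F ≡ 0) ⊎ (1 ≤ nEdges F)
  nEdges-zero-or-positive F with nEdges F
  ... | zero = inj₁ refl
  ... | suc n = inj₂ (s≤s z≤n)

  εCK-zero : ∀ (F : Forest D) → nEdges F ≡ 0 → εCK F ≡ 1#
  εCK-zero F e with nEdges F
  εCK-zero F refl | zero = refl

  εCK-positive : ∀ (F : Forest D) → 1 ≤ nEdges F → εCK F ≡ 0#
  εCK-positive F e with nEdges F
  εCK-positive F (s≤s _) | suc _ = refl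

  no-edges⇒unmarked : ∀ (F : Forest D) e → mapF proj₁ e ≡ F → nEdges F ≡ 0 → MarkedEdges.UnmarkedF {D × Bool} proj₂ e
  no-edges⇒unmarked F e pe e0 with edgesF e | trans (length-edgesF e) (trans (cong nEdges pe) e0)
  ... | [] | _ = []
  ... | _ ∷ _ | ()

  emptyLabelling : Forest D → Forest (D × Fin 0)
  emptyLabelling = map (λ _ → node [])

  emptyLabelling-unique : ∀ (G : Forest (D × Fin 0)) → G ≡ emptyLabelling (mapF proj₁ G)
  emptyLabelling-unique [] = refl
  emptyLabelling-unique (node [] ∷ G) = cong (node [] ∷_) (emptyLabelling-unique G)
  emptyLabelling-unique (node (((_ , ()) , _) ∷ _) ∷ G)

  edgesF-emptyLabelling : ∀ {X : Set} (G : Forest (X × Fin 0)) → edgesF G ≡ []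
  edgesF-emptyLabelling [] = refl
  edgesF-emptyLabelling (node [] ∷ G) = edgesF-emptyLabelling G
  edgesF-emptyLabelling (node (((_ , ()) , _) ∷ _) ∷ G)

  emptyLabelling-partition : ∀ (F : Forest D) → nEdges F ≡ 0 → IsGenPartition₀ F 0 (emptyLabelling F)
  emptyLabelling-partition F e = shape F e , z≤n , (λ ()) , (λ ()) , (λ _ _ ())
    where
    shape : ∀ (F : Forest D) → nEdges F ≡ 0 → mapF proj₁ (emptyLabelling F) ≡ F
    shape [] e = refl
    shape (node [] ∷ ts) e = cong (node [] ∷_) (shape ts e)
    shape (node ((_ , _) ∷ _) ∷ ts) ()

  no-empty-partition : ∀ {F : Forest D} → 1 ≤ nEdges F → ∀ G → ¬ IsGenPartition₀ F 0 G
  no-empty-partition {F} edges G (pG , _) = contradiction (subst (1 ≤_) edgeless edges) λ ()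
    where
    edgeless : nEdges F ≡ 0
    edgeless = trans (cong nEdges (sym pG)) (trans (sym (length-edgesF G)) (cong length (edgesF-emptyLabelling G)))

  φ-of : (Tree D → Lin) → Forest D → Lin
  φ-of φ (T ∷ []) = φ T
  φ-of φ _ = λ _ → 0#

  φ-tree-dropTrivial : ∀ (φ : Tree D → Lin) (X : Forest D) → φ-tree φ X ≡ φ-of φ (dropTrivial X)
  φ-tree-dropTrivial φ X with dropTrivial X
  ... | [] = refl
  ... | T ∷ [] = refl
  ... | T ∷ U ∷ r = refl

  φ-tree-cong : ∀ (φ : Tree D → Lin) {X Y : Forest D} → dropTrivial X ≡ dropTrivial Y → φ-tree φ X ≡ φ-tree φ Y
  φ-tree-cong φ {X} {Y} e = trans (φ-tree-dropTrivial φ X) (trans (cong (φ-of φ) e) (sym (φ-tree-dropTrivial φ Y)))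

  φ-of-not-single : ∀ (φ : Tree D → Lin) (X : Forest D) → (∀ T → X ≢ T ∷ []) → ∀ d → φ-of φ X d ≡ 0#
  φ-of-not-single φ [] ns d = refl
  φ-of-not-single φ (T ∷ []) ns d = contradiction refl (ns T)
  φ-of-not-single φ (T ∷ U ∷ r) ns d = refl

  single? : ∀ (X : Forest D) → (Σ (Tree D) λ T → X ≡ T ∷ []) ⊎ (∀ T → X ≢ T ∷ [])
  single? [] = inj₂ λ _ ()
  single? (T ∷ []) = inj₁ (T , refl)
  single? (T ∷ U ∷ r) = inj₂ λ _ ()

  term-∷ : ∀ (φ : Tree D → Lin) k (G : Forest (D × Fin (suc k))) d v →
           term φ (suc k , G) (d ∷ v) ≡ φ-tree φ (Cont (markCompl zero G)) d * term φ (k , restrict G) v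
  term-∷ φ k G d v = cong (λ z → φ-tree φ (Cont (markCompl zero G)) d * concatProd z v)
    (trans (map-tabulate suc (λ j → φ-tree φ (Cont (markCompl j G))))
    (trans (tabulate-cong (λ j → cong (φ-tree φ) (Cont-markCompl-suc j G)))
       (sym (map-tabulate id (λ j → φ-tree φ (Cont (markCompl j (restrict G))))))))

  partition-restrict : ∀ {F : Forest D} k (G : Forest (D × Fin (suc k))) → IsGenPartition₀ F (suc k) G →
       MarkedEdges.ConnectedF inFirst G × IsGenPartition₀ (Cont (markFirst G)) k (restrict G)
  partition-restrict {F} k G (pG , _ , conds) with conditions-restrict G conds
  ... | cn , conds′ = cn , shape-restrict G , bound , conds′
    where
    bound : k ≤ nEdges (Cont (markFirst G))
    bound = subst (k ≤_) (trans (length-map proj₂ (edgesF (restrict G))) (trans (length-edgesF (restrict G)) (cong nEdges (shape-restrict G))))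
              (covers⇒≤length (blocks (edgesF (restrict G))) (proj₁ conds′))

  partition-extend : ∀ {F : Forest D} (e : Forest (D × Bool)) → mapF proj₁ e ≡ F → MarkedEdges.ConnectedF {D × Bool} proj₂ e →
       ∀ k (G′ : Forest (D × Fin k)) → IsGenPartition₀ (Cont e) k G′ → IsGenPartition₀ F (suc k) (extend e G′)
  partition-extend {F} e pe cn k G′ (pG′ , _ , conds′) with restrict-extend e G′ pG′
  ... | mX , rX = projX , bound , condsX
    where
    X : Forest (D × Fin (suc k))
    X = extend e G′
    cnX : MarkedEdges.ConnectedF inFirst X
    cnX = Relabel.connectedF⁻ firstMark inFirst proj₂ (λ _ → refl) X (subst (MarkedEdges.ConnectedF proj₂) (sym mX) cn)
    condsX : PartitionConditions (suc k) X
    condsX = conditions-unrestrict X cnX (subst (PartitionConditions k) (sym rX) conds′)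
    projX : mapF proj₁ X ≡ F
    projX = trans (sym (shape-markFirst X)) (trans (cong (mapF proj₁) mX) pe)
    bound : suc k ≤ nEdges F
    bound = subst (suc k ≤_) (trans (length-map proj₂ (edgesF X)) (trans (length-edgesF X) (cong nEdges projX))) (covers⇒≤length (blocks (edgesF X)) (proj₁ condsX))

  first-block-connected : ∀ {F : Forest D} k (G : Forest (D × Fin (suc k))) → IsGenPartition₀ F (suc k) G → MarkedEdges.ConnectedF {D × Bool} proj₂ (markFirst G)
  first-block-connected k G gp = Relabel.connectedF⁺ firstMark inFirst proj₂ (λ _ → refl) (proj₁ (partition-restrict k G gp))

  firstBlockIs-sound : ∀ {F : Forest D} (e : Forest (D × Bool)) k (G : Forest (D × Fin (suc k))) →
                       mapF proj₁ e ≡ F → mapF proj₁ G ≡ F → T (firstBlockIs e (suc k , G)) → markFirst G ≡ e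
  firstBlockIs-sound e k G pe pG t = marks-injectiveF (markFirst G) e (trans (shape-markFirst G) (trans pG (sym pe))) (sym (eqBits-sound _ _ t))

  module _ (φ : Tree D → Lin) (Φ : Forest D → Sh) (isΦ : IsΦ φ Φ) where
    open IsΦ isΦ

    Φ-letter-++ : ∀ (F G : Forest D) d → Φ (F ++ G) (d ∷ []) ≈ Φ F (d ∷ []) * εCK G + εCK F * Φ G (d ∷ [])
    Φ-letter-++ F G d = begin
      Φ (F ++ G) (d ∷ [])                                                   ≈⟨ mult F G (d ∷ []) ⟩
      Φ F (d ∷ []) * Φ G [] + (Φ F [] * Φ G (d ∷ []) + 0#)                  ≈⟨ +-cong (*-cong ≈refl (counit G)) (+-identityʳ _) ⟩
      Φ F (d ∷ []) * εCK G + Φ F [] * Φ G (d ∷ [])                          ≈⟨ +-cong ≈refl (*-cong (counit F) ≈refl) ⟩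
      Φ F (d ∷ []) * εCK G + εCK F * Φ G (d ∷ [])                           ∎

    Φ-letter : ∀ (G : Forest D) d → Φ G (d ∷ []) ≈ φ-tree φ G d
    Φ-letter [] d = unit (d ∷ [])
    Φ-letter (node [] ∷ ts) d = begin
      Φ (• ∷ ts) (d ∷ [])                                   ≈⟨ Φ-letter-++ (• ∷ []) ts d ⟩
      Φ (• ∷ []) (d ∷ []) * εCK ts + 1# * Φ ts (d ∷ [])     ≈⟨ +-cong (≈trans (*-cong (unit• (d ∷ [])) ≈refl) (zeroˡ _)) (*-identityˡ _) ⟩
      0# + Φ ts (d ∷ [])                                    ≈⟨ +-identityˡ _ ⟩
      Φ ts (d ∷ [])                                         ≈⟨ Φ-letter ts d ⟩
      φ-tree φ ts d                                         ≡⟨ cong (λ f → f d) (φ-tree-cong φ {ts} {• ∷ ts} refl) ⟩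
      φ-tree φ (• ∷ ts) d                                   ∎
    Φ-letter (node ((l , t) ∷ cs) ∷ ts) d = begin
      Φ (T₁ ∷ ts) (d ∷ [])                                  ≈⟨ Φ-letter-++ (T₁ ∷ []) ts d ⟩
      Φ (T₁ ∷ []) (d ∷ []) * εCK ts + 0# * Φ ts (d ∷ [])    ≈⟨ ≈trans (+-cong ≈refl (zeroˡ _)) (+-identityʳ _) ⟩
      Φ (T₁ ∷ []) (d ∷ []) * εCK ts                         ≈⟨ *-cong (πΦi T₁ (s≤s z≤n) d) ≈refl ⟩
      φ T₁ d * εCK ts                                       ≈⟨ tail ts ⟩
      φ-tree φ (T₁ ∷ ts) d                                  ∎
      where
      T₁ : Tree D
      T₁ = node ((l , t) ∷ cs)
      tail : ∀ ts → φ T₁ d * εCK ts ≈ φ-tree φ (T₁ ∷ ts) d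
      tail ts with nEdges-zero-or-positive ts
      ... | inj₁ e0 = ≈trans (*-cong ≈refl (reflexive (εCK-zero ts e0))) (≈trans (*-identityʳ _)
                        (reflexive (cong (λ f → f d) (φ-tree-cong φ {T₁ ∷ []} {T₁ ∷ ts} (cong (T₁ ∷_) (sym (edgeless-trivial ts e0)))))))
        where
        edgeless-trivial : ∀ ts → nEdges ts ≡ 0 → dropTrivial ts ≡ []
        edgeless-trivial [] _ = refl
        edgeless-trivial (node [] ∷ ts) e = edgeless-trivial ts e
        edgeless-trivial (node ((_ , _) ∷ _) ∷ ts) ()
      ... | inj₂ edges = ≈trans (*-cong ≈refl (reflexive (εCK-positive ts edges))) (≈trans (zeroʳ _) (reflexive (sym nontrivial)))
        where
        two-trees : ∀ ts → 1 ≤ nEdges ts → ∀ T → dropTrivial (T₁ ∷ ts) ≢ T ∷ []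
        two-trees (node [] ∷ ts) e = two-trees ts e
        two-trees (node ((_ , _) ∷ _) ∷ ts) e T ()
        nontrivial : φ-tree φ (T₁ ∷ ts) d ≡ 0#
        nontrivial = trans (cong (λ f → f d) (φ-tree-dropTrivial φ (T₁ ∷ ts))) (φ-of-not-single φ _ (two-trees ts edges) d)

    Expansion : Word → Set ℓ
    Expansion w = ∀ F Ps → Unique Ps → Enumerates F Ps → Φ F w ≈ ∑ (λ P → term φ P w) Ps

    expansion-[] : Expansion []
    expansion-[] F Ps u en with nEdges-zero-or-positive F
    ... | inj₁ e0 = begin
          Φ F []                              ≈⟨ counit F ⟩
          εCK F                               ≡⟨ εCK-zero F e0 ⟩
          1#                                  ≈⟨ ≈sym (+-identityʳ 1#) ⟩
          1# + 0#                             ≡⟨ cong (∑ (λ P → term φ P [])) (sym Ps≡empty) ⟩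
          ∑ (λ P → term φ P []) Ps            ∎
      where
      only-empty : ∀ {P} → P ∈ Ps → P ≡ (0 , emptyLabelling F)
      only-empty {k , G} m with proj₁ (en k G) m
      ... | pG , k≤0 , _ with NatP.n≤0⇒n≡0 (subst (k ≤_) e0 k≤0)
      ...   | refl = cong (0 ,_) (trans (emptyLabelling-unique G) (cong emptyLabelling pG))
      Ps≡empty : Ps ≡ (0 , emptyLabelling F) ∷ []
      Ps≡empty = Unique-singleton (0 , emptyLabelling F) Ps u only-empty (proj₂ (en 0 (emptyLabelling F)) (emptyLabelling-partition F e0))
    ... | inj₂ edges = ≈trans (counit F) (≈trans (reflexive (εCK-positive F edges)) (≈sym (∑-zero _ Ps nonempty-blocks)))
      where
      nonempty-blocks : ∀ {P} → P ∈ Ps → term φ P [] ≈ 0#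
      nonempty-blocks {zero , G} m = contradiction (proj₁ (en 0 G) m) (no-empty-partition edges G)
      nonempty-blocks {suc k , G} m = ≈refl

    expansion-∷-no-edges : ∀ d v F Ps → Enumerates F Ps → nEdges F ≡ 0 → Φ F (d ∷ v) ≈ ∑ (λ P → term φ P (d ∷ v)) Ps
    expansion-∷-no-edges d v F Ps en e0 = ≈trans (comult F (d ∷ []) v) (≈trans (∑-zero _ (subsetsF F) no-part) (≈sym (∑-zero _ Ps no-term)))
      where
      no-part : ∀ {e} → e ∈ subsetsF F → Φ (Part e) (d ∷ []) * Φ (Cont e) v ≈ 0#
      no-part {e} m = ≈trans (*-cong (≈trans (Φ-letter (Part e) d) (reflexive (cong (λ f → f d) φ-Part≡0))) ≈refl) (zeroˡ _)
        where
        φ-Part≡0 : φ-tree φ (Part e) ≡ λ _ → 0#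
        φ-Part≡0 = trans (φ-tree-dropTrivial φ (Part e))
                         (cong (φ-of φ) (unmarked⇒Part-trivial e (no-edges⇒unmarked F e (All.lookup (shape-subsetsF F) m) e0)))
      no-term : ∀ {P} → P ∈ Ps → term φ P (d ∷ v) ≈ 0#
      no-term {zero , G} m = ≈refl
      no-term {suc k , G} m with subst (suc k ≤_) e0 (proj₁ (proj₂ (proj₁ (en (suc k) G) m)))
      ... | ()

    module Summand (d : D) (v : Word) (ih : Expansion v) {F : Forest D} {Ps : List Labelling} (u : Unique Ps) (en : Enumerates F Ps)
                   (e : Forest (D × Bool)) (pe : mapF proj₁ e ≡ F) where
      Selected : List Labelling
      Selected = filterᵇ (firstBlockIs e) Ps

      selected⁻ : ∀ {P} → P ∈ Selected → Σ ℕ λ k → Σ (Forest (D × Fin (suc k))) λ G →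
                  P ≡ (suc k , G) × (suc k , G) ∈ Ps × IsGenPartition₀ F (suc k) G × markFirst G ≡ e
      selected⁻ {zero , G} m = ⊥-elim (proj₂ (∈-filter⁻ (T? ∘ firstBlockIs e) {xs = Ps} m))
      selected⁻ {suc k , G} m with ∈-filter⁻ (T? ∘ firstBlockIs e) {xs = Ps} m
      ... | mPs , t = k , G , refl , mPs , gp , firstBlockIs-sound e k G pe (proj₁ gp) t
        where
        gp : IsGenPartition₀ F (suc k) G
        gp = proj₁ (en (suc k) G) mPs

      restricted-unique : Unique (map restrictLabelling Selected)
      restricted-unique = Unique-map⁺ restrictLabelling Selected (UniqueP.filter⁺ (T? ∘ firstBlockIs e) u) injective
        where
        injective : ∀ {P Q} → P ∈ Selected → Q ∈ Selected → restrictLabelling P ≡ restrictLabelling Q → P ≡ Q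
        injective mP mQ eq with selected⁻ mP | selected⁻ mQ
        ... | k , G , refl , _ , _ , me | k′ , G′ , refl , _ , _ , me′ with cong proj₁ eq
        ...   | refl = cong (suc k ,_)
                  (trans (sym (extend-restrict G)) (trans (cong₂ extend (trans me (sym me′)) (,-injectiveʳ-Labelling eq)) (extend-restrict G′)))

      restricted-enumerates : MarkedEdges.ConnectedF {D × Bool} proj₂ e → Enumerates (Cont e) (map restrictLabelling Selected)
      restricted-enumerates cn k′ G′ = to , from
        where
        to : (k′ , G′) ∈ map restrictLabelling Selected → IsGenPartition₀ (Cont e) k′ G′
        to m with ∈-map⁻ restrictLabelling m
        ... | P , mP , eqP with selected⁻ mP
        ...   | k , G , refl , _ , gp , me =
                subst (λ p → IsGenPartition₀ (Cont e) (proj₁ p) (proj₂ p)) (sym eqP)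
                  (subst (λ z → IsGenPartition₀ (Cont z) k (restrict G)) me (proj₂ (partition-restrict k G gp)))
        from : IsGenPartition₀ (Cont e) k′ G′ → (k′ , G′) ∈ map restrictLabelling Selected
        from gp with restrict-extend e G′ (proj₁ gp)
        ... | mX , rX = subst (λ z → (k′ , z) ∈ map restrictLabelling Selected) rX
                          (∈-map⁺ restrictLabelling (∈-filter⁺ (T? ∘ firstBlockIs e) (proj₂ (en (suc k′) X) (partition-extend e pe cn k′ G′ gp)) selected))
          where
          X : Forest (D × Fin (suc k′))
          X = extend e G′
          selected : T (firstBlockIs e (suc k′ , X))
          selected = subst (λ z → T (eqBits (bitsF e) (bitsF z))) (sym mX) (eqBits-refl (bitsF e))

      summand : φ-tree φ (Part e) d * Φ (Cont e) v ≈ ∑ (λ P → term φ P (d ∷ v)) Selected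
      summand with single? (dropTrivial (Part e))
      ... | inj₁ (T₁ , eqX) = begin
          φ-tree φ (Part e) d * Φ (Cont e) v                                    ≈⟨ *-cong ≈refl (ih (Cont e) _ restricted-unique (restricted-enumerates cn)) ⟩
          φ-tree φ (Part e) d * ∑ (λ P → term φ P v) (map restrictLabelling Selected) ≡⟨ cong (φ-tree φ (Part e) d *_) (∑-map (λ P → term φ P v) restrictLabelling Selected) ⟩
          φ-tree φ (Part e) d * ∑ (λ P → term φ (restrictLabelling P) v) Selected ≈⟨ ∑-*ˡ _ _ Selected ⟩
          ∑ (λ P → φ-tree φ (Part e) d * term φ (restrictLabelling P) v) Selected ≈⟨ ∑-cong _ _ Selected (λ m → reflexive (first-factor m)) ⟩
          ∑ (λ P → term φ P (d ∷ v)) Selected                                   ∎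
        where
        cn : MarkedEdges.ConnectedF proj₂ e
        cn = Part-single⇒connected e eqX
        first-factor : ∀ {P} → P ∈ Selected → φ-tree φ (Part e) d * term φ (restrictLabelling P) v ≡ term φ P (d ∷ v)
        first-factor m with selected⁻ m
        ... | k , G , refl , _ , gp , me = sym (trans (term-∷ φ k G d v) (cong (λ f → f d * term φ (k , restrict G) v) (φ-tree-cong φ {Cont (markCompl zero G)} {Part e} first-block)))
          where
          first-block : dropTrivial (Cont (markCompl zero G)) ≡ dropTrivial (Part e)
          first-block with connected⇒Part≡contComplement cn
          ... | _ , _ , part , cont = trans (cong dropTrivial (trans (Cont-markCompl-zero G) (cong (Cont ∘ mapF complementMark) me))) (trans cont (sym part))
      ... | inj₂ not-single = ≈trans (≈trans (*-cong (reflexive φ-Part≡0) ≈refl) (zeroˡ _)) (≈sym (∑-zero _ Selected (λ m → ⊥-elim (disconnected m))))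
        where
        φ-Part≡0 : φ-tree φ (Part e) d ≡ 0#
        φ-Part≡0 = trans (cong (λ f → f d) (φ-tree-dropTrivial φ (Part e))) (φ-of-not-single φ _ not-single d)
        disconnected : ∀ {P} → P ∈ Selected → ⊥
        disconnected m with selected⁻ m
        ... | k , G , refl , _ , gp , me with connected⇒Part≡contComplement (subst (MarkedEdges.ConnectedF proj₂) me (first-block-connected k G gp))
        ...   | _ , _ , part , _ = not-single _ part

    expansion-∷ : ∀ d v → Expansion v → Expansion (d ∷ v)
    expansion-∷ d v ih F Ps u en with nEdges-zero-or-positive F
    ... | inj₁ e0 = expansion-∷-no-edges d v F Ps en e0
    ... | inj₂ edges = begin
        Φ F (d ∷ v)                                                                   ≈⟨ comult F (d ∷ []) v ⟩
        ∑ (λ e → Φ (Part e) (d ∷ []) * Φ (Cont e) v) (subsetsF F)                      ≈⟨ ∑-cong _ _ (subsetsF F) (λ {e} _ → *-cong (Φ-letter (Part e) d) ≈refl) ⟩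
        ∑ (λ e → φ-tree φ (Part e) d * Φ (Cont e) v) (subsetsF F)                      ≈⟨ ∑-cong _ _ (subsetsF F) (λ {e} m → Summand.summand d v ih u en e (All.lookup (shape-subsetsF F) m)) ⟩
        ∑ (λ e → ∑ (λ P → term φ P (d ∷ v)) (filterᵇ (firstBlockIs e) Ps)) (subsetsF F) ≈⟨ ∑-regroup (λ P → term φ P (d ∷ v)) firstBlockIs (subsetsF F) Ps first-block-unique ⟩
        ∑ (λ P → term φ P (d ∷ v)) Ps                                                  ∎
      where
      first-block-unique : ∀ {P} → P ∈ Ps → count (λ e → firstBlockIs e P) (subsetsF F) ≡ 1
      first-block-unique {zero , G} m = contradiction (proj₁ (en 0 G) m) (no-empty-partition edges G)
      first-block-unique {suc k , G} m = count-subsetsF F (markFirst G) (trans (shape-markFirst G) (proj₁ (proj₁ (en (suc k) G) m)))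

    expansion : ∀ w → Expansion w
    expansion [] = expansion-[]
    expansion (d ∷ v) = expansion-∷ d v (expansion v)

open Expansion

mainTheorem17 : ∀ {c ℓ} (K : CommutativeRing c ℓ) → IsField K → CharZero K
    → (D : Set) → D
    → let open Alg K D in
    (φ : Tree D → Lin) → IsTreeMap φ
    → (Φ : Forest D → Sh) → IsΦ φ Φ
    → (F : Forest D) → 1 ≤ nEdges F
    → (Ps : List (Σ ℕ λ k → Forest (D × Fin k)))
    → Unique Ps
    → (∀ k G → ((k , G) ∈ Ps → IsGenPartition F k G) × (IsGenPartition F k G → (k , G) ∈ Ps))
    → Φ F ≐ (λ w → Σ' (map (λ p → term φ p w) Ps))
mainTheorem17 K _ _ D _ φ _ Φ isΦ F edges Ps u enumerates w = expansion K D φ Φ isΦ w F Ps u enumerates₀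
  where
  enumerates₀ : Enumerates K D F Ps
  enumerates₀ k G = (λ m → drop-lower-bound (proj₁ (enumerates k G) m)) , (λ gp → proj₂ (enumerates k G) (add-lower-bound k G gp))
    where
    drop-lower-bound : IsGenPartition F k G → IsGenPartition₀ K D F k G
    drop-lower-bound (shape , _ , bound , conds) = shape , bound , conds
    add-lower-bound : ∀ k G → IsGenPartition₀ K D F k G → IsGenPartition F k G
    add-lower-bound zero G gp = contradiction gp (no-empty-partition K D edges G)
    add-lower-bound (suc k) G (shape , bound , conds) = shape , s≤s z≤n , bound , conds
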